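{- There exists an infinite family of words $w$ such that $r_{\$}(w)-r(w)=\Theta(\sqrt n)$, where $n=|w|$.
   Context: Words are over a finite ordered alphabet; $\$$ is an extra symbol smaller than all letters. For a word $w$, $\mathrm{BWT}(w)$ is obtained by sorting the conjugates $w[i..n-1]w[0..i-1]$ lexicographically and concatenating their last characters; $r(w)$ is the number of maximal equal-letter runs of $\mathrm{BWT}(w)$ and $r_{\$}(w)$ that of $\mathrm{BWT}(w\$)$. $\Theta$ is understood uniformly over the family. -}

module Defs where

open import Data.Nat using (ℕ; zero; suc; _+_; _<ᵇ_; _≡ᵇ_)
open import Data.Bool using (Bool; true; false; if_then_else_)
open import Data.Fin using (Fin; toℕ)
open import Data.List using (List; []; _∷_; _++_; map; drop; take; length; upTo; [_])

-- Letters of the alphabet Fin σ are encoded as suc (toℕ a); the end-marker $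
-- is encoded as 0, so it is smaller than every letter and the order on
-- letters is preserved.
encode : ∀ {σ} → List (Fin σ) → List ℕ
encode = map (λ a → suc (toℕ a))

lexLeq : List ℕ → List ℕ → Bool
lexLeq [] _ = true
lexLeq (_ ∷ _) [] = false
lexLeq (x ∷ xs) (y ∷ ys) =
  if x <ᵇ y then true else (if y <ᵇ x then false else lexLeq xs ys)

insert : List ℕ → List (List ℕ) → List (List ℕ)
insert u [] = u ∷ []
insert u (v ∷ vs) = if lexLeq u v then u ∷ v ∷ vs else v ∷ insert u vs

sortWords : List (List ℕ) → List (List ℕ)
sortWords [] = []
sortWords (u ∷ us) = insert u (sortWords us)

rotate : ℕ → List ℕ → List ℕ
rotate i w = drop i w ++ take i w

conjugates : List ℕ → List (List ℕ)
conjugates w = map (λ i → rotate i w) (upTo (length w))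

lastOr0 : List ℕ → ℕ
lastOr0 [] = 0
lastOr0 (x ∷ []) = x
lastOr0 (_ ∷ y ∷ ys) = lastOr0 (y ∷ ys)

-- Burrows–Wheeler transform: last characters of the sorted conjugates
-- (equal conjugates have equal last characters, so ties are harmless)
bwt : List ℕ → List ℕ
bwt w = map lastOr0 (sortWords (conjugates w))

runsFrom : ℕ → List ℕ → ℕ
runsFrom _ [] = 0
runsFrom x (y ∷ ys) = (if x ≡ᵇ y then 0 else 1) + runsFrom y ys

runs : List ℕ → ℕ
runs [] = 0
runs (x ∷ xs) = suc (runsFrom x xs)

r : ∀ {σ} → List (Fin σ) → ℕ
r w = runs (bwt (encode w))

r$ : ∀ {σ} → List (Fin σ) → ℕ
r$ w = runs (bwt (encode w ++ [ 0 ]))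

{-# OPTIONS --safe #-}
module Submission where

-- The words are 𝐳 (𝐛𝐚𝐛𝐚𝐜ᵉ) (𝐛²𝐚𝐛²𝐚𝐜ᵉ⁻¹) ⋯ (𝐛ᵉ𝐚𝐛ᵉ𝐚𝐜) 𝐛ᵉ⁺¹, of length Θ(e²).  Sorted, their conjugates fall
-- into O(e) consecutive classes whose members are all preceded by the same letter, so the BWT has exactly as many
-- runs as the sequence of class letters, which is counted by hand.  The conjugates starting 𝐛ⁱ𝐚 (level i) give
-- the letters 𝐜 𝐛 𝐚; appending $ puts the conjugate 𝐛ⁱ$…, preceded by 𝐛, in front of level i, turning them into
-- 𝐛 𝐜 𝐛 𝐚.  Hence r$ − r grows like e, that is, like √n.

open import Defs
open import Data.Bool using (true; false; if_then_else_)
open import Data.Fin using (Fin; toℕ) renaming (zero to fz; suc to fs)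
open import Data.List using (List; []; _∷_; _++_; [_]; map; length; replicate; drop; take)
open import Data.List.Membership.Propositional using (_∈_)
open import Data.List.Membership.Propositional.Properties using (∈-map⁻; ∈-map⁺; ∈-upTo⁺; ∈-upTo⁻)
open import Data.List.Properties
  using (++-assoc; ++-identityʳ; ∷-injective; length-++; length-map; length-replicate; map-cong-local; map-∘; map-id;
         take++drop≡id)
open import Data.List.Relation.Binary.Permutation.Propositional using (_↭_; ↭-refl; ↭-prep; ↭-swap; ↭-trans; ↭-sym)
open import Data.List.Relation.Binary.Permutation.Propositional.Properties using (∈-resp-↭)
open import Data.List.Relation.Unary.All as All using (All)
open import Data.List.Relation.Unary.All.Properties using (++⁺; replicate⁺)
open import Data.List.Relation.Unary.Any using (here; there)
open import Data.List.Relation.Unary.Linked as Linked using (Linked; []; [-]; _∷_)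
open import Data.List.Relation.Unary.Linked.Properties using (Linked⇒All; map⁺)
open import Data.Nat using (ℕ; zero; suc; _+_; _*_; _∸_; _≤_; _<_; z≤n; s≤s; z<s; s<s; _<ᵇ_; _≡ᵇ_; _≟_)
open import Data.Nat.Properties
open import Data.Nat.Tactic.RingSolver using (solve-∀)
open import Data.Product using (Σ; ∃; ∃₂; _×_; _,_; proj₁; proj₂)
open import Data.Sum using (_⊎_; inj₁; inj₂)
import Data.Sum as Sum
open import Data.Unit using (⊤; tt)
open import Function using (_∘_)
open import Relation.Binary.Definitions using (tri<; tri≈; tri>)
open import Relation.Binary.PropositionalEquality hiding ([_])
open import Relation.Nullary using (¬_; contradiction; yes; no)

-- lexLeq is a total order, so lexLeq v u ≡ false says that u is strictly below v.
infix 4 _≼_ _≺_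

_≼_ _≺_ : List ℕ → List ℕ → Set
u ≼ v = lexLeq u v ≡ true
u ≺ v = lexLeq v u ≡ false

≮⇒<ᵇ≡false : ∀ {m n} → ¬ m < n → (m <ᵇ n) ≡ false
≮⇒<ᵇ≡false {m} {n} m≮n with m <ᵇ n | <ᵇ⇒< m n
... | false | _   = refl
... | true  | m<n = contradiction (m<n _) m≮n

<⇒<ᵇ≡true : ∀ {m n} → m < n → (m <ᵇ n) ≡ true
<⇒<ᵇ≡true {m} {n} m<n with m <ᵇ n | <⇒<ᵇ m<n
... | true | _ = refl

lexLeq-≡ : ∀ x xs ys → lexLeq (x ∷ xs) (x ∷ ys) ≡ lexLeq xs ys
lexLeq-≡ x xs ys rewrite ≮⇒<ᵇ≡false (n≮n x) = refl

lexLeq-< : ∀ {x y} xs ys → x < y → x ∷ xs ≼ y ∷ ys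
lexLeq-< xs ys x<y rewrite <⇒<ᵇ≡true x<y = refl

lexLeq-> : ∀ {x y} xs ys → y < x → y ∷ ys ≺ x ∷ xs
lexLeq-> {x} {y} xs ys y<x rewrite ≮⇒<ᵇ≡false (<⇒≯ y<x) | <⇒<ᵇ≡true y<x = refl

lexLeq-++ : ∀ p u v → lexLeq (p ++ u) (p ++ v) ≡ lexLeq u v
lexLeq-++ []      u v = refl
lexLeq-++ (x ∷ p) u v = trans (lexLeq-≡ x (p ++ u) (p ++ v)) (lexLeq-++ p u v)

≼-refl : ∀ u → u ≼ u
≼-refl []      = refl
≼-refl (x ∷ u) = trans (lexLeq-≡ x u u) (≼-refl u)

prefix-≼ : ∀ p v → p ≼ p ++ v
prefix-≼ []      v = refl
prefix-≼ (x ∷ p) v = trans (lexLeq-≡ x p (p ++ v)) (prefix-≼ p v)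

≼-∷⁻ : ∀ {x y xs ys} → x ∷ xs ≼ y ∷ ys → x < y ⊎ (x ≡ y × xs ≼ ys)
≼-∷⁻ {x} {y} {xs} {ys} h with <-cmp x y
... | tri< x<y _ _ = inj₁ x<y
... | tri≈ _ refl _ = inj₂ (refl , trans (sym (lexLeq-≡ x xs ys)) h)
... | tri> _ _ y<x with () ← trans (sym h) (lexLeq-> xs ys y<x)

≼-trans : ∀ {u v w} → u ≼ v → v ≼ w → u ≼ w
≼-trans {[]} _ _ = refl
≼-trans {x ∷ u} {[]} ()
≼-trans {x ∷ u} {y ∷ v} {[]} _ ()
≼-trans {x ∷ u} {y ∷ v} {z ∷ w} u≼v v≼w with ≼-∷⁻ {x} {y} {u} {v} u≼v | ≼-∷⁻ {y} {z} {v} {w} v≼w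
... | inj₁ x<y         | inj₁ y<z         = lexLeq-< u w (<-trans x<y y<z)
... | inj₁ x<y         | inj₂ (refl , _)  = lexLeq-< u w x<y
... | inj₂ (refl , _)  | inj₁ y<z         = lexLeq-< u w y<z
... | inj₂ (refl , p)  | inj₂ (refl , q)  = trans (lexLeq-≡ x u w) (≼-trans {u} {v} {w} p q)

≺⇒≼ : ∀ {u v} → u ≺ v → u ≼ v
≺⇒≼ {u} {[]} ()
≺⇒≼ {[]} {y ∷ v} _ = refl
≺⇒≼ {x ∷ u} {y ∷ v} h with <-cmp x y
... | tri< x<y _ _ = lexLeq-< u v x<y
... | tri≈ _ refl _ = trans (lexLeq-≡ x u v) (≺⇒≼ {u} {v} (trans (sym (lexLeq-≡ x v u)) h))
... | tri> _ _ y<x with () ← trans (sym h) (lexLeq-< v u y<x)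

≼-≺-trans : ∀ {u v w} → u ≼ v → w ≺ u → w ≺ v
≼-≺-trans {u} {v} {w} u≼v w≺u with lexLeq v w in v≼w
... | false = refl
... | true with () ← trans (sym (≼-trans {u} {v} {w} u≼v v≼w)) w≺u

insert-linked : ∀ u {vs} → Linked _≼_ vs → Linked _≼_ (insert u vs)
insert-linked u []              = [-]
insert-linked u {v ∷ vs} sorted with lexLeq u v in u≼v
... | true  = u≼v ∷ sorted
... | false = insert-after v (≺⇒≼ {v} {u} u≼v) sorted
  where
  insert-after : ∀ v {vs} → v ≼ u → Linked _≼_ (v ∷ vs) → Linked _≼_ (v ∷ insert u vs)
  insert-after v v≼u [-] = v≼u ∷ [-]
  insert-after v {w ∷ ws} v≼u (v≼w ∷ sorted) with lexLeq u w in u≼w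
  ... | true  = v≼u ∷ u≼w ∷ sorted
  ... | false = v≼w ∷ insert-after w (≺⇒≼ {w} {u} u≼w) sorted

sortWords-linked : ∀ L → Linked _≼_ (sortWords L)
sortWords-linked []       = []
sortWords-linked (u ∷ us) = insert-linked u (sortWords-linked us)

insert-↭ : ∀ u vs → insert u vs ↭ u ∷ vs
insert-↭ u []       = ↭-refl
insert-↭ u (v ∷ vs) with lexLeq u v
... | true  = ↭-refl
... | false = ↭-trans (↭-prep v (insert-↭ u vs)) (↭-swap v u ↭-refl)

sortWords-↭ : ∀ L → sortWords L ↭ L
sortWords-↭ []       = ↭-refl
sortWords-↭ (u ∷ us) = ↭-trans (insert-↭ u (sortWords us)) (↭-prep u (sortWords-↭ us))

-- classes of a sorted list of words

-- A class (B , p) holds the words from the boundary B up to the next boundary; p is the letter preceding them.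
Class : Set
Class = List ℕ × ℕ

boundaries : List Class → List (List ℕ)
boundaries = map proj₁

letters : List Class → List ℕ
letters = map proj₂

Below : List ℕ → List Class → Set
Below u []            = ⊤
Below u ((B , _) ∷ _) = u ≺ B

record InClass (cs : List Class) (u : List ℕ) : Set where
  constructor inClass
  field
    pre      : List Class
    boundary : List ℕ
    letter   : ℕ
    post     : List Class
    split    : cs ≡ pre ++ (boundary , letter) ∷ post
    above    : boundary ≼ u
    below    : Below u post
    preceded : lastOr0 u ≡ letter

Inhabited : List (List ℕ) → List Class → Set
Inhabited L []             = ⊤
Inhabited L ((B , _) ∷ cs) = (∃ λ u → u ∈ L × B ≼ u × Below u cs) × Inhabited L cs

rank : List (List ℕ) → List ℕ → ℕ
rank []       u = 0
rank (B ∷ Bs) u = (if lexLeq B u then 1 else 0) + rank Bs u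

rank-mono : ∀ Bs {u v} → u ≼ v → rank Bs u ≤ rank Bs v
rank-mono []       u≼v = z≤n
rank-mono (B ∷ Bs) {u} {v} u≼v with lexLeq B u in B≼u | lexLeq B v in B≼v
... | true  | true  = s≤s (rank-mono Bs u≼v)
... | false | true  = m≤n⇒m≤1+n (rank-mono Bs u≼v)
... | false | false = rank-mono Bs u≼v
... | true  | false with () ← trans (sym (≼-trans {B} {u} {v} B≼u u≼v)) B≼v

head-≼ : ∀ {C B Bs} → Linked _≼_ (C ∷ Bs) → B ∈ Bs → C ≼ B
head-≼ (C≼D ∷ _)                      (here refl) = C≼D
head-≼ {C} {B} {D ∷ _} (C≼D ∷ sorted) (there B∈Bs) = ≼-trans {C} {D} {B} C≼D (head-≼ sorted B∈Bs)

boundary-∈ : ∀ pre {B p post} → B ∈ boundaries (pre ++ (B , p) ∷ post)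
boundary-∈ []      = here refl
boundary-∈ (_ ∷ pre) = there (boundary-∈ pre)

rank-below : ∀ {B Bs u} → Linked _≼_ (B ∷ Bs) → u ≺ B → rank (B ∷ Bs) u ≡ 0
rank-below [-] u≺B rewrite u≺B = refl
rank-below {B} {B′ ∷ _} {u} (B≼B′ ∷ sorted) u≺B rewrite u≺B =
  rank-below sorted (≼-≺-trans {B} {B′} {u} B≼B′ u≺B)

rank-inClass : ∀ pre {B p post u} → Linked _≼_ (boundaries (pre ++ (B , p) ∷ post)) →
               B ≼ u → Below u post → rank (boundaries (pre ++ (B , p) ∷ post)) u ≡ suc (length pre)
rank-inClass [] {post = []}        _                B≼u _   rewrite B≼u = refl
rank-inClass [] {post = _ ∷ _}     (_ ∷ sorted)     B≼u u≺B rewrite B≼u = cong suc (rank-below sorted u≺B)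
rank-inClass ((C , _) ∷ pre) {B} {u = u} sorted B≼u u≺post
  rewrite ≼-trans {C} {B} {u} (head-≼ sorted (boundary-∈ pre)) B≼u =
  cong suc (rank-inClass pre (Linked.tail sorted) B≼u u≺post)

interval : ℕ → ℕ → List ℕ
interval s zero    = []
interval s (suc n) = s ∷ interval (suc s) n

Spans : List ℕ → ℕ → ℕ → Set
Spans K s n = (∀ {v} → v ∈ K → s ≤ v × v < s + n) × (∀ {v} → s ≤ v → v < s + n → v ∈ K)

head-≤ : ∀ {v w K} → Linked _≤_ (v ∷ K) → w ∈ K → v ≤ w
head-≤ sorted w∈K = All.lookup (Linked⇒All ≤-trans ≤-refl sorted) (there w∈K)

head-start : ∀ {v K s n} → Linked _≤_ (v ∷ K) → Spans (v ∷ K) s n → v ≡ s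
head-start {v} {K} {s} sorted (range , onto) with range (here refl)
... | s≤v , v<s+n with onto ≤-refl (≤-<-trans s≤v v<s+n)
...   | here s≡v   = sym s≡v
...   | there s∈K = ≤-antisym (head-≤ sorted s∈K) s≤v

≡ᵇ-refl : ∀ n → (n ≡ᵇ n) ≡ true
≡ᵇ-refl zero    = refl
≡ᵇ-refl (suc n) = ≡ᵇ-refl n

newRun : ℕ → ℕ → ℕ
newRun x y = if x ≡ᵇ y then 0 else 1

runsFrom-self : ∀ y ys → runsFrom y (y ∷ ys) ≡ runsFrom y ys
runsFrom-self y ys rewrite ≡ᵇ-refl y = refl

runsFrom-dup : ∀ x y ys → runsFrom x (y ∷ y ∷ ys) ≡ runsFrom x (y ∷ ys)
runsFrom-dup x y ys = cong (newRun x y +_) (runsFrom-self y ys)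

runsFrom-spanning : ∀ (h : ℕ → ℕ) K {s n} x → Linked _≤_ K → Spans K s n →
                    runsFrom x (map h K) ≡ runsFrom x (map h (interval s n))
runsFrom-spanning h [] {n = zero} x _ _ = refl
runsFrom-spanning h [] {s} {suc n} x _ (_ , onto) with () ← onto ≤-refl (m<m+n s z<s)
runsFrom-spanning h (v ∷ K) x sorted spans with head-start sorted spans
runsFrom-spanning h (s ∷ K) {n = zero} x sorted (range , _) | refl
  with () ← <-irrefl (sym (+-identityʳ s)) (proj₂ (range (here refl)))
runsFrom-spanning h (s ∷ []) {n = suc zero} x sorted spans | refl = refl
runsFrom-spanning h (s ∷ []) {n = suc (suc n)} x sorted (_ , onto) | refl
  with onto (n≤1+n s) (subst (suc s <_) (sym (+-suc s (suc n))) (s<s (m<m+n s z<s)))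
... | here s+1≡s with () ← <-irrefl (sym s+1≡s) (n<1+n s)
runsFrom-spanning h (s ∷ v ∷ K) {n = suc n} x (s≤v ∷ sorted) (range , onto) | refl with v ≟ s
... | yes refl = trans (runsFrom-dup x (h s) (map h K))
                       (runsFrom-spanning h (s ∷ K) x sorted (range ∘ there , onto′))
  where
  onto′ : ∀ {w} → s ≤ w → w < s + suc n → w ∈ s ∷ K
  onto′ s≤w w<  with onto s≤w w<
  ... | here w≡s  = here w≡s
  ... | there w∈ = w∈
... | no v≢s = cong (newRun x (h s) +_)
                    (runsFrom-spanning h (v ∷ K) (h s) sorted (range′ , onto′))
  where
  s<v : s < v
  s<v = ≤∧≢⇒< s≤v (v≢s ∘ sym)
  range′ : ∀ {w} → w ∈ v ∷ K → suc s ≤ w × w < suc s + n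
  range′ (here refl)     = s<v , subst (v <_) (+-suc s n) (proj₂ (range (there (here refl))))
  range′ {w} (there w∈K) = <-≤-trans s<v (head-≤ sorted w∈K)
                         , subst (w <_) (+-suc s n) (proj₂ (range (there (there w∈K))))
  onto′ : ∀ {w} → suc s ≤ w → w < suc s + n → w ∈ v ∷ K
  onto′ {w} s<w w< with onto (<⇒≤ s<w) (subst (w <_) (sym (+-suc s n)) w<)
  ... | here refl with () ← n≮n s s<w
  ... | there w∈ = w∈

runs-spanning : ∀ (h : ℕ → ℕ) K {s n} → Linked _≤_ K → Spans K s n →
                runs (map h K) ≡ runs (map h (interval s n))
runs-spanning h [] {n = zero} _ _ = refl
runs-spanning h [] {s} {suc n} _ (_ , onto) with () ← onto ≤-refl (m<m+n s z<s)
runs-spanning h (v ∷ K) {s} {n} sorted spans with head-start sorted spans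
runs-spanning h (s ∷ K) {n = zero} sorted (range , _) | refl
  with () ← <-irrefl (sym (+-identityʳ s)) (proj₂ (range (here refl)))
runs-spanning h (s ∷ K) {n = suc n} sorted spans | refl =
  cong suc (trans (sym (runsFrom-self (h s) (map h K)))
                  (trans (runsFrom-spanning h (s ∷ K) (h s) sorted spans)
                         (runsFrom-self (h s) (map h (interval (suc s) n)))))

lookupOr0 : List ℕ → ℕ → ℕ
lookupOr0 []       _       = 0
lookupOr0 (p ∷ ps) zero    = p
lookupOr0 (p ∷ ps) (suc k) = lookupOr0 ps k

lookupOr0-letters : ∀ pre {B p post} → lookupOr0 (letters (pre ++ (B , p) ∷ post)) (length pre) ≡ p
lookupOr0-letters []        = refl
lookupOr0-letters (_ ∷ pre) = lookupOr0-letters pre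

map-interval-suc : ∀ (f : ℕ → ℕ) s n → map f (interval (suc s) n) ≡ map (f ∘ suc) (interval s n)
map-interval-suc f s zero    = refl
map-interval-suc f s (suc n) = cong (f (suc s) ∷_) (map-interval-suc f (suc s) n)

map-lookupOr0-interval : ∀ d ps → map (lookupOr0 (d ∷ ps)) (interval 1 (length ps)) ≡ ps
map-lookupOr0-interval d []       = refl
map-lookupOr0-interval d (p ∷ ps) =
  cong (p ∷_) (trans (map-interval-suc (lookupOr0 (d ∷ p ∷ ps)) 1 (length ps)) (map-lookupOr0-interval p ps))

length-pre< : ∀ {A : Set} {cs pre post : List A} {c} → cs ≡ pre ++ c ∷ post → length pre < length cs
length-pre< {pre = pre} refl = subst (length pre <_) (sym (length-++ pre)) (m<m+n (length pre) z<s)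

rank-InClass : ∀ {cs u} → Linked _≼_ (boundaries cs) → (c : InClass cs u) →
               rank (boundaries cs) u ≡ suc (length (InClass.pre c))
rank-InClass sorted (inClass pre _ _ _ refl above below _) = rank-inClass pre sorted above below

rank-Inhabited : ∀ {L cs} → Linked _≼_ (boundaries cs) → ∀ pre {post} → cs ≡ pre ++ post → Inhabited L post →
                 ∀ {k} → k < length post → ∃ λ u → u ∈ L × rank (boundaries cs) u ≡ suc (length pre + k)
rank-Inhabited sorted pre {_ ∷ _} refl ((u , u∈L , B≼u , u≺post) , _) {zero} _ =
  u , u∈L , trans (rank-inClass pre sorted B≼u u≺post) (cong suc (sym (+-identityʳ (length pre))))
rank-Inhabited sorted pre {c ∷ post} cs≡ (_ , inhabited) {suc k} (s≤s k<)
  with u , u∈L , rank≡ ← rank-Inhabited sorted (pre ++ [ c ]) (trans cs≡ (sym (++-assoc pre [ c ] post))) inhabited k<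
      =
  u , u∈L , trans rank≡ (cong suc (trans (cong (_+ k) (length-++ pre)) (+-assoc (length pre) 1 k)))

-- A member of the k-th class has rank k; along the sorted list the ranks are nondecreasing and, every class
-- being inhabited, take all the values 1, …, |cs|.  So the last letters there are the class letters, repeated.
runs-by-classes : ∀ L cs → Linked _≼_ (boundaries cs) → Inhabited L cs → (∀ {u} → u ∈ L → InClass cs u) →
                  runs (map lastOr0 (sortWords L)) ≡ runs (letters cs)
runs-by-classes L cs sorted inhabited classify = begin
  runs (map lastOr0 S)
    ≡⟨ cong runs (map-cong-local (All.tabulate (letter-rank ∘ ∈S⇒∈L))) ⟩
  runs (map (letterOf ∘ κ) S)
    ≡⟨ cong runs (map-∘ S) ⟩
  runs (map letterOf (map κ S))
    ≡⟨ runs-spanning letterOf (map κ S) ranks-sorted (ranks-range , ranks-onto) ⟩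
  runs (map letterOf (interval 1 (length cs)))
    ≡⟨ cong (λ n → runs (map letterOf (interval 1 n))) (sym (length-map proj₂ cs)) ⟩
  runs (map letterOf (interval 1 (length (letters cs))))
    ≡⟨ cong runs (map-lookupOr0-interval 0 (letters cs)) ⟩
  runs (letters cs) ∎
  where
  open ≡-Reasoning
  S = sortWords L
  κ = rank (boundaries cs)
  letterOf = lookupOr0 (0 ∷ letters cs)   -- ranks start at 1; position 0 is a dummy

  ∈S⇒∈L : ∀ {u} → u ∈ S → u ∈ L
  ∈S⇒∈L = ∈-resp-↭ (sortWords-↭ L)

  letter-rank : ∀ {u} → u ∈ L → lastOr0 u ≡ letterOf (κ u)
  letter-rank u∈L with c@(inClass pre _ _ _ split _ _ preceded) ← classify u∈L
    rewrite rank-InClass sorted c | split = trans preceded (sym (lookupOr0-letters pre))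

  ranks-sorted : Linked _≤_ (map κ S)
  ranks-sorted = map⁺ (Linked.map (λ {u} {v} → rank-mono (boundaries cs) {u} {v}) (sortWords-linked L))

  ranks-range : ∀ {v} → v ∈ map κ S → 1 ≤ v × v < 1 + length cs
  ranks-range v∈ with u , u∈S , refl ← ∈-map⁻ κ v∈
    rewrite rank-InClass sorted (classify (∈S⇒∈L u∈S)) =
    s≤s z≤n , s≤s (length-pre< (InClass.split (classify (∈S⇒∈L u∈S))))

  ranks-onto : ∀ {v} → 1 ≤ v → v < 1 + length cs → v ∈ map κ S
  ranks-onto {suc k} _ (s≤s k<) with u , u∈L , rank≡ ← rank-Inhabited sorted [] refl inhabited k< =
    subst (_∈ map κ S) rank≡ (∈-map⁺ κ (∈-resp-↭ (↭-sym (sortWords-↭ L)) u∈L))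

-- encode sends the letters 0, 1, 2, 3 of Fin 4 to 𝐚, 𝐛, 𝐜, 𝐳; the end-marker $ is 0
𝐚 𝐛 𝐜 𝐳 : ℕ
𝐚 = 1
𝐛 = 2
𝐜 = 3
𝐳 = 4

infix 8 _^_

_^_ : ℕ → ℕ → List ℕ
c ^ n = replicate n c

NonEmpty : List ℕ → Set
NonEmpty xs = ∃₂ λ y ys → xs ≡ y ∷ ys

drop-length-++ : ∀ (p s : List ℕ) → drop (length p) (p ++ s) ≡ s
drop-length-++ []      s = refl
drop-length-++ (x ∷ p) s = drop-length-++ p s

take-length-++ : ∀ (p s : List ℕ) → take (length p) (p ++ s) ≡ p
take-length-++ []      s = refl
take-length-++ (x ∷ p) s = cong (x ∷_) (take-length-++ p s)

drop-nonEmpty : ∀ i (X : List ℕ) → i < length X → NonEmpty (drop i X)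
drop-nonEmpty zero    (x ∷ X) _       = x , X , refl
drop-nonEmpty (suc i) (x ∷ X) (s≤s i<) = drop-nonEmpty i X i<

∈-conjugates⁺ : ∀ {X} p y ys → X ≡ p ++ y ∷ ys → (y ∷ ys) ++ p ∈ conjugates X
∈-conjugates⁺ p y ys refl =
  subst (_∈ conjugates (p ++ y ∷ ys)) rotate-length
        (∈-map⁺ (λ i → rotate i (p ++ y ∷ ys)) (∈-upTo⁺ p<))
  where
  p< : length p < length (p ++ y ∷ ys)
  p< = subst (length p <_) (sym (length-++ p)) (m<m+n (length p) z<s)
  rotate-length : rotate (length p) (p ++ y ∷ ys) ≡ (y ∷ ys) ++ p
  rotate-length = cong₂ _++_ (drop-length-++ p (y ∷ ys)) (take-length-++ p (y ∷ ys))

∈-conjugates⁻ : ∀ X {u} → u ∈ conjugates X → ∃₂ λ p s → X ≡ p ++ s × NonEmpty s × u ≡ s ++ p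
∈-conjugates⁻ X u∈ with i , i∈ , refl ← ∈-map⁻ (λ i → rotate i X) u∈ =
  take i X , drop i X , sym (take++drop≡id i X) , drop-nonEmpty i X (∈-upTo⁻ i∈) , refl

++-split : ∀ P {R p s : List ℕ} → p ++ s ≡ P ++ R →
           (∃ λ q → P ≡ p ++ q × s ≡ q ++ R × NonEmpty q) ⊎ (∃ λ q → p ≡ P ++ q × R ≡ q ++ s)
++-split []      {p = p}     eq = inj₂ (p , refl , sym eq)
++-split (x ∷ P) {p = []}    eq = inj₁ (x ∷ P , refl , eq , x , P , refl)
++-split (x ∷ P) {p = _ ∷ p} eq with refl , eq′ ← ∷-injective eq =
  Sum.map (λ (q , P≡ , s≡ , q≢[]) → q , cong (x ∷_) P≡ , s≡ , q≢[])
          (λ (q , p≡ , R≡) → q , cong (x ∷_) p≡ , R≡)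
          (++-split P eq′)

^-split : ∀ n c {p q : List ℕ} → c ^ n ≡ p ++ q → NonEmpty q →
          ∃₂ λ a i → n ≡ a + suc i × p ≡ c ^ a × q ≡ c ^ suc i
^-split zero    c {[]}    {[]} refl (_ , _ , ())
^-split (suc n) c {[]}         eq   _ = 0 , n , refl , refl , sym eq
^-split (suc n) c {_ ∷ p} {q}  eq   q≢[] with refl , eq′ ← ∷-injective eq
  with a , i , n≡ , p≡ , q≡ ← ^-split n c {p} {q} eq′ q≢[] =
  suc a , i , cong suc n≡ , cong (c ∷_) p≡ , q≡

^-∷ʳ : ∀ n (c : ℕ) → c ^ suc n ≡ c ^ n ++ [ c ]
^-∷ʳ zero    c = refl
^-∷ʳ (suc n) c = cong (c ∷_) (^-∷ʳ n c)

^-+ : ∀ a b (c : ℕ) → c ^ (a + b) ≡ c ^ a ++ c ^ b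
^-+ zero    b c = refl
^-+ (suc a) b c = cong (c ∷_) (^-+ a b c)

lastOr0-++ : ∀ (xs ys : List ℕ) → NonEmpty ys → lastOr0 (xs ++ ys) ≡ lastOr0 ys
lastOr0-++ []            ys _               = refl
lastOr0-++ (x ∷ [])      ys (_ , _ , refl) = refl
lastOr0-++ (x ∷ x′ ∷ xs) ys ys≢[]          = lastOr0-++ (x′ ∷ xs) ys ys≢[]

lastOr0-∷ʳ : ∀ (xs : List ℕ) c → lastOr0 (xs ++ [ c ]) ≡ c
lastOr0-∷ʳ xs c = lastOr0-++ xs [ c ] (c , [] , refl)

lastOr0-^ : ∀ n c → lastOr0 (c ^ suc n) ≡ c
lastOr0-^ zero    c = refl
lastOr0-^ (suc n) c = lastOr0-^ n c

block : ℕ → ℕ → List ℕ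
block j e = 𝐛 ^ j ++ 𝐚 ∷ 𝐛 ^ j ++ 𝐚 ∷ 𝐜 ^ e

blocks : ℕ → ℕ → List ℕ
blocks j zero    = []
blocks j (suc e) = block j (suc e) ++ blocks (suc j) e

-- word e [ 0 ] is word e [] followed by the end-marker $.
word : ℕ → List ℕ → List ℕ
word e E = 𝐳 ∷ blocks 1 e ++ 𝐛 ^ suc e ++ E

letterBefore : ℕ → ℕ
letterBefore (suc zero) = 𝐳
letterBefore _          = 𝐜

++-∷-++-∷-assoc : ∀ (P₁ : List ℕ) a P₂ b P₃ W → (P₁ ++ a ∷ P₂ ++ b ∷ P₃) ++ W ≡ P₁ ++ a ∷ P₂ ++ b ∷ P₃ ++ W
++-∷-++-∷-assoc P₁ a P₂ b P₃ W =
  trans (++-assoc P₁ (a ∷ P₂ ++ b ∷ P₃) W) (cong (λ t → P₁ ++ a ∷ t) (++-assoc P₂ (b ∷ P₃) W))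

block-∷ʳ-𝐜 : ∀ j e → ∃ λ I → block j (suc e) ≡ I ++ [ 𝐜 ]
block-∷ʳ-𝐜 j e = 𝐛 ^ j ++ 𝐚 ∷ 𝐛 ^ j ++ 𝐚 ∷ 𝐜 ^ e ,
  trans (cong (λ t → 𝐛 ^ j ++ 𝐚 ∷ 𝐛 ^ j ++ 𝐚 ∷ t) (^-∷ʳ e 𝐜))
      (sym (++-∷-++-∷-assoc (𝐛 ^ j) 𝐚 (𝐛 ^ j) 𝐚 (𝐜 ^ e) [ 𝐜 ]))

blocks-∷ʳ-𝐜 : ∀ j e → ∃ λ I → blocks j (suc e) ≡ I ++ [ 𝐜 ]
blocks-∷ʳ-𝐜 j zero    with I , eq ← block-∷ʳ-𝐜 j 0 = I , trans (++-identityʳ _) eq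
blocks-∷ʳ-𝐜 j (suc e) with I , eq ← blocks-∷ʳ-𝐜 (suc j) e =
  block j (suc (suc e)) ++ I , trans (cong (block j (suc (suc e)) ++_) eq)
      (sym (++-assoc (block j (suc (suc e))) I [ 𝐜 ]))

-- A cut of p ++ s inside blocks j e: it falls in block j′, after the blocks `earlier`.
record BlockCut (j e : ℕ) (R p s : List ℕ) : Set where
  constructor blockCut
  field
    j′ e′       : ℕ
    earlier x y : List ℕ
    index       : j′ + suc e′ ≡ j + e
    p≡          : p ≡ earlier ++ x
    s≡          : s ≡ y ++ blocks (suc j′) e′ ++ R
    cut         : x ++ y ≡ block j′ (suc e′)
    y≢[]        : NonEmpty y
    first∨after : (earlier ≡ [] × j′ ≡ j) ⊎ (∃ λ P → earlier ≡ P ++ [ 𝐜 ] × j < j′)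

blocks-split : ∀ j e R p s → p ++ s ≡ blocks j e ++ R → NonEmpty s →
               (∃ λ q → p ≡ blocks j e ++ q × R ≡ q ++ s) ⊎ BlockCut j e R p s
blocks-split j zero    R p s eq _ = inj₁ (p , refl , sym eq)
blocks-split j (suc e) R p s eq s≢[]
  with ++-split (block j (suc e)) (trans eq (++-assoc (block j (suc e)) (blocks (suc j) e) R))
... | inj₁ (q , B≡ , s≡ , q≢[]) = inj₂ (blockCut j e [] p q refl refl s≡ (sym B≡) q≢[] (inj₁ (refl , refl)))
... | inj₂ (q , p≡ , q≡) with blocks-split (suc j) e R q s (sym q≡) s≢[]
...   | inj₁ (q′ , q≡′ , R≡) =
        inj₁ (q′ , trans p≡ (trans (cong (block j (suc e) ++_) q≡′) (sym (++-assoc (block j (suc e)) _ q′))) , R≡)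
...   | inj₂ (blockCut j′ e′ earlier x y index p≡′ s≡ cut y≢[] first∨after) =
        inj₂ (blockCut j′ e′ (block j (suc e) ++ earlier) x y (trans index (sym (+-suc j e)))
                (trans p≡ (trans (cong (block j (suc e) ++_) p≡′) (sym (++-assoc (block j (suc e)) earlier x))))
                s≡ cut y≢[] (after first∨after))
  where
  after : (earlier ≡ [] × j′ ≡ suc j) ⊎ (∃ λ P → earlier ≡ P ++ [ 𝐜 ] × suc j < j′) →
          (block j (suc e) ++ earlier ≡ [] × j′ ≡ j) ⊎ (∃ λ P → block j (suc e) ++ earlier ≡ P ++ [ 𝐜 ] × j < j′)
  after (inj₁ (refl , refl)) with I , eq ← block-∷ʳ-𝐜 j e = inj₂ (I , trans (++-identityʳ _) eq , n<1+n j)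
  after (inj₂ (P , refl , j<j′)) =
    inj₂ (block j (suc e) ++ P , sym (++-assoc (block j (suc e)) P [ 𝐜 ]) , <-trans (n<1+n j) j<j′)

data ConjugateShape (e : ℕ) (E : List ℕ) (u : List ℕ) : Set where
  from-𝐳               : u ≡ word e E → ConjugateShape e E u
  from-$               : E ≡ [ 0 ] → lastOr0 u ≡ 𝐛 → (rest : List ℕ) → u ≡ 0 ∷ rest → ConjugateShape e E u
  from-tail            : lastOr0 u ≡ 𝐜 → (rest : List ℕ) → u ≡ 𝐛 ^ suc e ++ E ++ 𝐳 ∷ rest → ConjugateShape e E u
  from-inside-tail     : (i : ℕ) → i < e → lastOr0 u ≡ 𝐛 → (rest : List ℕ) →
                         u ≡ 𝐛 ^ suc i ++ E ++ 𝐳 ∷ rest → ConjugateShape e E u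
  from-𝐚               : lastOr0 u ≡ 𝐛 → (rest : List ℕ) → u ≡ 𝐚 ∷ rest → ConjugateShape e E u
  from-block           : (k e′ : ℕ) → k + suc e′ ≡ e → lastOr0 u ≡ letterBefore (suc k) → (rest : List ℕ) →
                         u ≡ 𝐛 ^ suc k ++ 𝐚 ∷ 𝐛 ^ suc k ++ 𝐚 ∷ rest → ConjugateShape e E u
  from-inside-first-𝐛s : (i j : ℕ) → suc i < j → j ≤ e → lastOr0 u ≡ 𝐛 → (rest : List ℕ) →
                         u ≡ 𝐛 ^ suc i ++ 𝐚 ∷ 𝐛 ^ j ++ rest → ConjugateShape e E u
  from-second-𝐛s       : (k e′ : ℕ) → k + suc e′ ≡ e → lastOr0 u ≡ 𝐚 → (rest : List ℕ) →
                         u ≡ 𝐛 ^ suc k ++ 𝐚 ∷ 𝐜 ^ suc e′ ++ 𝐛 ∷ rest → ConjugateShape e E u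
  from-inside-second-𝐛s : (i k e′ : ℕ) → suc i < suc k → k + suc e′ ≡ e → lastOr0 u ≡ 𝐛 → (rest : List ℕ) →
                         u ≡ 𝐛 ^ suc i ++ 𝐚 ∷ 𝐜 ^ suc e′ ++ 𝐛 ∷ rest → ConjugateShape e E u
  from-𝐜s              : (k e′ : ℕ) → k + suc e′ ≡ e → lastOr0 u ≡ 𝐚 → (rest : List ℕ) →
                         u ≡ 𝐜 ^ suc e′ ++ 𝐛 ^ suc (suc k) ++ rest → ConjugateShape e E u
  from-inside-𝐜s       : (i k e′ : ℕ) → i < e′ → k + suc e′ ≡ e → lastOr0 u ≡ 𝐜 → (rest : List ℕ) →
                         u ≡ 𝐜 ^ suc i ++ 𝐛 ^ suc (suc k) ++ 𝐚 ∷ rest → ConjugateShape e E u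

following-𝐛 : ∀ j e e₀ E → ∃ λ t → blocks (suc j) e ++ 𝐛 ^ suc e₀ ++ E ≡ 𝐛 ∷ t
following-𝐛 j zero    e₀ E = _ , refl
following-𝐛 j (suc e) e₀ E = _ , refl

following-𝐛ʲ𝐚 : ∀ j e e₀ E → ∃ λ t → blocks (suc j) (suc e) ++ 𝐛 ^ suc e₀ ++ E ≡ 𝐛 ^ suc j ++ 𝐚 ∷ t
following-𝐛ʲ𝐚 j e e₀ E = _ , trans (++-assoc (block (suc j) (suc e)) _ _) (++-assoc (𝐛 ^ suc j) (𝐚 ∷ _) _)

following-𝐛ʲ : ∀ j e e₀ E → j + suc e ≡ suc e₀ → ∃ λ t → blocks (suc j) e ++ 𝐛 ^ suc e₀ ++ E ≡ 𝐛 ^ suc j ++ t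
following-𝐛ʲ j zero    e₀ E eq with refl ← suc-injective (trans (+-comm 1 j) eq) = E , refl
following-𝐛ʲ j (suc e) e₀ E _  with t , eq ← following-𝐛ʲ𝐚 j e e₀ E = 𝐚 ∷ t , eq

lastOr0-rotation : ∀ s P x → NonEmpty x → lastOr0 (s ++ 𝐳 ∷ P ++ x) ≡ lastOr0 x
lastOr0-rotation s P x x≢[] = trans (lastOr0-++ s (𝐳 ∷ P ++ x) (𝐳 , _ , refl)) (lastOr0-++ (𝐳 ∷ P) x x≢[])

lastOr0-rotation-[] : ∀ s P → lastOr0 (s ++ 𝐳 ∷ P ++ []) ≡ lastOr0 (𝐳 ∷ P)
lastOr0-rotation-[] s P =
  trans (lastOr0-++ s (𝐳 ∷ P ++ []) (𝐳 , _ , refl)) (cong (λ t → lastOr0 (𝐳 ∷ t)) (++-identityʳ P))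

lastOr0-^-++-[] : ∀ k c → lastOr0 (c ^ suc k ++ []) ≡ c
lastOr0-^-++-[] k c = trans (cong lastOr0 (++-identityʳ (c ^ suc k))) (lastOr0-^ k c)

^-nonEmpty : ∀ n c (xs : List ℕ) → NonEmpty (c ^ suc n ++ xs)
^-nonEmpty n c xs = c , _ , refl

<-of-+-suc : ∀ {k e n} → k + suc e ≡ n → k < n
<-of-+-suc {k} {e} refl = subst (k <_) (sym (+-suc k e)) (s≤s (m≤m+n k e))

letterBefore-suc : ∀ {k} → 1 ≤ k → letterBefore (suc k) ≡ 𝐜
letterBefore-suc (s≤s z≤n) = refl

module BlockShapes (e₀ : ℕ) (E : List ℕ) (k e′ : ℕ) (earlier : List ℕ) (index : k + suc e′ ≡ e₀) where

  after-block : List ℕ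
  after-block = blocks (suc (suc k)) e′ ++ 𝐛 ^ suc e₀ ++ E

  Rotation : List ℕ → List ℕ → List ℕ
  Rotation x y = (y ++ after-block) ++ 𝐳 ∷ earlier ++ x

  letterBefore-block : ∀ s → (earlier ≡ [] × k ≡ 0) ⊎ (∃ λ P → earlier ≡ P ++ [ 𝐜 ] × 1 ≤ k) →
                       lastOr0 (s ++ 𝐳 ∷ earlier ++ []) ≡ letterBefore (suc k)
  letterBefore-block s (inj₁ (refl , k≡0)) =
    trans (lastOr0-rotation-[] s []) (sym (cong (letterBefore ∘ suc) k≡0))
  letterBefore-block s (inj₂ (P , refl , 1≤k)) =
    trans (trans (lastOr0-rotation-[] s (P ++ [ 𝐜 ])) (lastOr0-∷ʳ (𝐳 ∷ P) 𝐜)) (sym (letterBefore-suc 1≤k))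

  in-first-𝐛s : ∀ {x q} → (earlier ≡ [] × k ≡ 0) ⊎ (∃ λ P → earlier ≡ P ++ [ 𝐜 ] × 1 ≤ k) →
                𝐛 ^ suc k ≡ x ++ q → NonEmpty q →
                ConjugateShape e₀ E (Rotation x (q ++ 𝐚 ∷ 𝐛 ^ suc k ++ 𝐚 ∷ 𝐜 ^ suc e′))
  in-first-𝐛s {x} {q} first∨after eq q≢[] with ^-split (suc k) 𝐛 {x} {q} eq q≢[]
  ... | zero , _ , refl , refl , refl =
    from-block k e′ index (letterBefore-block (Y ++ after-block) first∨after) _
      (trans (++-assoc Y after-block _) (++-∷-++-∷-assoc (𝐛 ^ suc k) 𝐚 (𝐛 ^ suc k) 𝐚 (𝐜 ^ suc e′) _))
    where Y = 𝐛 ^ suc k ++ 𝐚 ∷ 𝐛 ^ suc k ++ 𝐚 ∷ 𝐜 ^ suc e′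
  ... | suc a , i , refl , refl , refl =
    from-inside-first-𝐛s i (suc k) (s≤s (m≤n+m (suc i) a)) (<-of-+-suc index)
      (trans (lastOr0-rotation (Y ++ after-block) earlier (𝐛 ^ suc a) (𝐛 , _ , refl)) (lastOr0-^ a 𝐛)) _
      (trans (++-assoc Y after-block _) (++-∷-++-∷-assoc (𝐛 ^ suc i) 𝐚 (𝐛 ^ suc k) 𝐚 (𝐜 ^ suc e′) _))
    where Y = 𝐛 ^ suc i ++ 𝐚 ∷ 𝐛 ^ suc k ++ 𝐚 ∷ 𝐜 ^ suc e′

  in-second-𝐛s : ∀ {q′ q} → 𝐛 ^ suc k ≡ q′ ++ q → NonEmpty q →
                 ConjugateShape e₀ E (Rotation (𝐛 ^ suc k ++ 𝐚 ∷ q′) (q ++ 𝐚 ∷ 𝐜 ^ suc e′))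
  in-second-𝐛s {q′} {q} eq q≢[] with ^-split (suc k) 𝐛 {q′} {q} eq q≢[] | following-𝐛 (suc k) e′ e₀ E
  ... | zero , _ , refl , refl , refl | t , Post≡ =
    from-second-𝐛s k e′ index
      (trans (lastOr0-rotation (Y ++ after-block) earlier (𝐛 ^ suc k ++ [ 𝐚 ]) (^-nonEmpty k 𝐛 _))
          (lastOr0-∷ʳ (𝐛 ^ suc k) 𝐚))
      (t ++ _)
      (trans (++-assoc Y after-block _) (trans (++-assoc (𝐛 ^ suc k) (𝐚 ∷ 𝐜 ^ suc e′) _)
        (cong (λ t → 𝐛 ^ suc k ++ 𝐚 ∷ 𝐜 ^ suc e′ ++ t ++ _) Post≡)))
    where Y = 𝐛 ^ suc k ++ 𝐚 ∷ 𝐜 ^ suc e′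
  ... | suc a , i , refl , refl , refl | t , Post≡ =
    from-inside-second-𝐛s i k e′ (s≤s (m≤n+m (suc i) a)) index
      (trans (lastOr0-rotation (Y ++ after-block) earlier (𝐛 ^ suc k ++ 𝐚 ∷ 𝐛 ^ suc a) (^-nonEmpty k 𝐛 _))
             (trans (lastOr0-++ (𝐛 ^ suc k) (𝐚 ∷ 𝐛 ^ suc a) (𝐚 , _ , refl)) (lastOr0-^ a 𝐛)))
      (t ++ _)
      (trans (++-assoc Y after-block _) (trans (++-assoc (𝐛 ^ suc i) (𝐚 ∷ 𝐜 ^ suc e′) _)
        (cong (λ t → 𝐛 ^ suc i ++ 𝐚 ∷ 𝐜 ^ suc e′ ++ t ++ _) Post≡)))
    where Y = 𝐛 ^ suc i ++ 𝐚 ∷ 𝐜 ^ suc e′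

  in-𝐜s : ∀ {q y} → 𝐜 ^ suc e′ ≡ q ++ y → NonEmpty y →
          ConjugateShape e₀ E (Rotation (𝐛 ^ suc k ++ 𝐚 ∷ 𝐛 ^ suc k ++ 𝐚 ∷ q) y)
  in-𝐜s {q} {y} eq y≢[] with ^-split (suc e′) 𝐜 {q} {y} eq y≢[]
  ... | zero , _ , refl , refl , refl with t , Post≡ ← following-𝐛ʲ (suc k) e′ e₀ E (cong suc index) =
    from-𝐜s k e′ index
      (trans (lastOr0-rotation (𝐜 ^ suc e′ ++ after-block) earlier X (^-nonEmpty k 𝐛 _))
        (trans (lastOr0-++ (𝐛 ^ suc k) (𝐚 ∷ 𝐛 ^ suc k ++ [ 𝐚 ]) (𝐚 , _ , refl)) (lastOr0-∷ʳ (𝐚 ∷ 𝐛 ^ suc k) 𝐚)))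
      (t ++ _)
      (trans (++-assoc (𝐜 ^ suc e′) after-block _)
        (trans (cong (λ t → 𝐜 ^ suc e′ ++ t ++ _) Post≡) (cong (𝐜 ^ suc e′ ++_) (++-assoc (𝐛 ^ suc (suc k)) t _))))
    where X = 𝐛 ^ suc k ++ 𝐚 ∷ 𝐛 ^ suc k ++ [ 𝐚 ]
  ... | suc a , i , refl , refl , refl with t , Post≡ ← following-𝐛ʲ𝐚 (suc k) (a + i) e₀ E =
    from-inside-𝐜s i k (a + suc i) (m≤n+m (suc i) a) index
      (trans (lastOr0-rotation (𝐜 ^ suc i ++ after-block) earlier X (^-nonEmpty k 𝐛 _))
        (trans (lastOr0-++ (𝐛 ^ suc k) (𝐚 ∷ 𝐛 ^ suc k ++ 𝐚 ∷ 𝐜 ^ suc a) (𝐚 , _ , refl))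
          (trans (lastOr0-++ (𝐚 ∷ 𝐛 ^ suc k) (𝐚 ∷ 𝐜 ^ suc a) (𝐚 , _ , refl)) (lastOr0-^ a 𝐜))))
      (t ++ _)
      (trans (++-assoc (𝐜 ^ suc i) after-block _)
        (trans (cong (λ t → 𝐜 ^ suc i ++ t ++ _)
                     (trans (cong (λ n → blocks (suc (suc k)) n ++ 𝐛 ^ suc e₀ ++ E) (+-suc a i)) Post≡))
          (cong (𝐜 ^ suc i ++_) (++-assoc (𝐛 ^ suc (suc k)) (𝐚 ∷ t) _))))
    where X = 𝐛 ^ suc k ++ 𝐚 ∷ 𝐛 ^ suc k ++ 𝐚 ∷ 𝐜 ^ suc a

  in-block : ∀ x y → (earlier ≡ [] × k ≡ 0) ⊎ (∃ λ P → earlier ≡ P ++ [ 𝐜 ] × 1 ≤ k) →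
             x ++ y ≡ block (suc k) (suc e′) → NonEmpty y → ConjugateShape e₀ E (Rotation x y)
  in-block x y first∨after cut y≢[] with ++-split (𝐛 ^ suc k) {𝐚 ∷ 𝐛 ^ suc k ++ 𝐚 ∷ 𝐜 ^ suc e′} {x} {y} cut
  ... | inj₁ (q , eq , refl , q≢[]) = in-first-𝐛s first∨after eq q≢[]
  ... | inj₂ ([] , refl , refl) =
    from-𝐚 (trans (lastOr0-rotation (y ++ after-block) earlier (𝐛 ^ suc k ++ []) (^-nonEmpty k 𝐛 []))
                  (lastOr0-^-++-[] k 𝐛)) _ refl
  ... | inj₂ (_ ∷ q′ , refl , eq) with refl , eq′ ← ∷-injective eq with ++-split (𝐛 ^ suc k) {𝐚 ∷ 𝐜 ^ suc e′} {q′} {y}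
        (sym eq′)
  ...   | inj₁ (q , eq″ , refl , q≢[]) = in-second-𝐛s eq″ q≢[]
  ...   | inj₂ ([] , refl , refl) =
    from-𝐚 (trans (lastOr0-rotation (y ++ after-block) earlier (𝐛 ^ suc k ++ 𝐚 ∷ 𝐛 ^ suc k ++ []) (^-nonEmpty k 𝐛 _))
                  (trans (lastOr0-++ (𝐛 ^ suc k) (𝐚 ∷ 𝐛 ^ suc k ++ []) (𝐚 , _ , refl)) (lastOr0-^-++-[] k 𝐛))) _ refl
  ...   | inj₂ (_ ∷ q₃ , refl , eq″) with refl , eq‴ ← ∷-injective eq″ = in-𝐜s eq‴ y≢[]

lastOr0-𝐳-blocks : ∀ e → 1 ≤ e → lastOr0 (𝐳 ∷ blocks 1 e) ≡ 𝐜
lastOr0-𝐳-blocks (suc e) _ with I , eq ← blocks-∷ʳ-𝐜 1 e =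
  trans (cong (λ t → lastOr0 (𝐳 ∷ t)) eq) (lastOr0-∷ʳ (𝐳 ∷ I) 𝐜)

blockCut-shape : ∀ e E {p s} → BlockCut 1 e (𝐛 ^ suc e ++ E) p s → ConjugateShape e E (s ++ 𝐳 ∷ p)
blockCut-shape e E (blockCut zero _ _ _ _ _ _ _ _ _ (inj₁ (_ , ())))
blockCut-shape e E (blockCut zero _ _ _ _ _ _ _ _ _ (inj₂ (_ , _ , ())))
blockCut-shape e E (blockCut (suc k) e′ earlier x y index refl refl cut y≢[] first∨after) =
  BlockShapes.in-block e E k e′ earlier (suc-injective index) x y (first∨after′ first∨after) cut y≢[]
  where
  first∨after′ : (earlier ≡ [] × suc k ≡ 1) ⊎ (∃ λ P → earlier ≡ P ++ [ 𝐜 ] × 1 < suc k) →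
                 (earlier ≡ [] × k ≡ 0) ⊎ (∃ λ P → earlier ≡ P ++ [ 𝐜 ] × 1 ≤ k)
  first∨after′ (inj₁ (earlier≡ , refl))     = inj₁ (earlier≡ , refl)
  first∨after′ (inj₂ (P , earlier≡ , s≤s 1≤k)) = inj₂ (P , earlier≡ , 1≤k)

tail-shape : ∀ e E {q s} → 1 ≤ e → E ≡ [] ⊎ E ≡ [ 0 ] → 𝐛 ^ suc e ++ E ≡ q ++ s → NonEmpty s →
             ConjugateShape e E (s ++ 𝐳 ∷ blocks 1 e ++ q)
tail-shape e E {q} {s} 1≤e E≡ eq s≢[] with ++-split (𝐛 ^ suc e) {E} {q} {s} (sym eq)
... | inj₁ (q′ , 𝐛s≡ , refl , q′≢[]) with ^-split (suc e) 𝐛 {q} {q′} 𝐛s≡ q′≢[]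
...   | zero , _ , refl , refl , refl =
  from-tail (trans (lastOr0-rotation-[] s (blocks 1 e)) (lastOr0-𝐳-blocks e 1≤e)) _ (++-assoc (𝐛 ^ suc e) E _)
...   | suc a , i , refl , refl , refl =
  from-inside-tail i (m≤n+m (suc i) a)
    (trans (lastOr0-rotation s (blocks 1 (a + suc i)) (𝐛 ^ suc a) (𝐛 , _ , refl)) (lastOr0-^ a 𝐛))
    _ (++-assoc (𝐛 ^ suc i) E _)
tail-shape e E 1≤e (inj₁ refl) eq (_ , _ , refl) | inj₂ ([]    , _ , ())
tail-shape e E 1≤e (inj₁ refl) eq (_ , _ , refl) | inj₂ (_ ∷ _ , _ , ())
tail-shape e E 1≤e (inj₂ refl) eq (_ , _ , refl) | inj₂ ([] , refl , refl) =
  from-$ refl (trans (lastOr0-rotation [ 0 ] (blocks 1 e) (𝐛 ^ suc e ++ []) (^-nonEmpty e 𝐛 []))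
      (lastOr0-^-++-[] e 𝐛))
    _ refl
tail-shape e E 1≤e (inj₂ refl) eq (_ , _ , refl) | inj₂ (_ ∷ [] , _ , ())
tail-shape e E 1≤e (inj₂ refl) eq (_ , _ , refl) | inj₂ (_ ∷ _ ∷ _ , _ , ())

conjugateShape : ∀ e E {u} → 1 ≤ e → E ≡ [] ⊎ E ≡ [ 0 ] → u ∈ conjugates (word e E) → ConjugateShape e E u
conjugateShape e E 1≤e E≡ u∈ with ∈-conjugates⁻ (word e E) u∈
... | [] , s , refl , _ , refl = from-𝐳 (++-identityʳ _)
... | _ ∷ p , s , eq , s≢[] , refl with refl , eq′ ← ∷-injective eq
  with blocks-split 1 e (𝐛 ^ suc e ++ E) p s (sym eq′) s≢[]
...   | inj₂ cut              = blockCut-shape e E cut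
...   | inj₁ (q , refl , eq″) = tail-shape e E 1≤e E≡ eq″ s≢[]

𝐛𝐚 : ℕ → List ℕ
𝐛𝐚 i = 𝐛 ^ i ++ [ 𝐚 ]

𝐛𝐚𝐛 : ℕ → List ℕ
𝐛𝐚𝐛 i = 𝐛 ^ i ++ 𝐚 ∷ 𝐛 ^ suc i

𝐛𝐚𝐜 : ℕ → ℕ → List ℕ
𝐛𝐚𝐜 i e = 𝐛 ^ i ++ 𝐚 ∷ 𝐜 ^ e

-- Level i holds the conjugates 𝐛ⁱ𝐚𝐛ⁱ𝐚… (preceded by the letter before block i), then 𝐛ⁱ𝐚𝐛ʲ… with j > i and
-- 𝐛ⁱ𝐚𝐜ᵐ𝐛… with m shorter than the 𝐜-run of block i (preceded by 𝐛), then 𝐛ⁱ𝐚 followed by that whole 𝐜-run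
-- (preceded by 𝐚).
levels : ℕ → ℕ → List Class → List Class
levels i zero          rest = rest
levels i (suc zero)    rest = (𝐛𝐚 i , letterBefore i) ∷ (𝐛𝐚𝐜 i 1 , 𝐚) ∷ rest
levels i (suc (suc e)) rest =
  (𝐛𝐚 i , letterBefore i) ∷ (𝐛𝐚𝐛 i , 𝐛) ∷ (𝐛𝐚𝐜 i (suc (suc e)) , 𝐚) ∷ levels (suc i) (suc e) rest

-- With the end-marker every level is preceded by the conjugate 𝐛ⁱ$…, whose letter 𝐛 separates the letter 𝐚
-- of the previous level from the letter 𝐜 before block i: one extra run per level.
levels$ : ℕ → ℕ → List Class → List Class
levels$ i zero          rest = rest
levels$ i (suc zero)    rest = (𝐛 ^ i , 𝐛) ∷ (𝐛𝐚 i , letterBefore i) ∷ (𝐛𝐚𝐜 i 1 , 𝐚) ∷ rest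
levels$ i (suc (suc e)) rest =
  (𝐛 ^ i , 𝐛) ∷ (𝐛𝐚 i , letterBefore i) ∷ (𝐛𝐚𝐛 i , 𝐛) ∷ (𝐛𝐚𝐜 i (suc (suc e)) , 𝐚) ∷ levels$ (suc i) (suc e) rest

-- Conjugates 𝐜ⁱ𝐛… starting inside a longer 𝐜-run (preceded by 𝐜) or at a whole 𝐜-run (preceded by 𝐚).
𝐜-levels : ℕ → ℕ → List Class → List Class
𝐜-levels i zero                rest = rest
𝐜-levels i (suc zero)          rest = rest
𝐜-levels i (suc (suc zero))    rest = rest
𝐜-levels i (suc (suc (suc e))) rest =
  (𝐜 ^ i ++ [ 𝐛 ] , 𝐜) ∷ (𝐜 ^ i ++ 𝐛 ^ suc (suc (suc e)) , 𝐚) ∷ 𝐜-levels (suc i) (suc (suc e)) rest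

𝐜-classes : ℕ → List Class
𝐜-classes e = 𝐜-levels 1 (suc e) [ ([ 𝐳 ] , 𝐛) ]

after-levels : ℕ → List Class
after-levels e = (𝐛 ^ suc e , 𝐜) ∷ (𝐛 ^ e ++ [ 𝐳 ] , 𝐛) ∷ 𝐜-classes e

classes : ℕ → List Class
classes e = ([] , 𝐛) ∷ levels 1 e (after-levels e)

𝐜-classes$ : ℕ → List Class
𝐜-classes$ e = 𝐜-levels 1 (suc e) [ ([ 𝐳 ] , 0) ]

after-levels$ : ℕ → List Class
after-levels$ e = (𝐛 ^ suc e , 𝐜) ∷ 𝐜-classes$ e

classes$ : ℕ → List Class
classes$ e = ([] , 𝐛) ∷ ([ 𝐚 ] , 𝐛) ∷ levels$ 1 e (after-levels$ e)

levels-++ : ∀ i e rest → levels i e rest ≡ levels i e [] ++ rest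
levels-++ i zero rest = refl
levels-++ i (suc zero) rest = refl
levels-++ i (suc (suc e)) rest = cong (λ t → _ ∷ _ ∷ _ ∷ t) (levels-++ (suc i) (suc e) rest)

levels$-++ : ∀ i e rest → levels$ i e rest ≡ levels$ i e [] ++ rest
levels$-++ i zero rest = refl
levels$-++ i (suc zero) rest = refl
levels$-++ i (suc (suc e)) rest = cong (λ t → _ ∷ _ ∷ _ ∷ _ ∷ t) (levels$-++ (suc i) (suc e) rest)

𝐜-levels-++ : ∀ i e rest → 𝐜-levels i e rest ≡ 𝐜-levels i e [] ++ rest
𝐜-levels-++ i zero rest = refl
𝐜-levels-++ i (suc zero) rest = refl
𝐜-levels-++ i (suc (suc zero)) rest = refl
𝐜-levels-++ i (suc (suc (suc e))) rest = cong (λ t → _ ∷ _ ∷ t) (𝐜-levels-++ (suc i) (suc (suc e)) rest)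

levels-split : ∀ i k e rest → ∃ λ F → levels i (k + suc e) rest ≡ F ++ levels (i + k) (suc e) rest
levels-split i zero e rest = [] , cong (λ t → levels t (suc e) rest) (sym (+-identityʳ i))
levels-split i (suc k) e rest with levels-split (suc i) k e rest
... | (F , eq) = (𝐛𝐚 i , letterBefore i) ∷ (𝐛𝐚𝐛 i , 𝐛) ∷ (𝐛𝐚𝐜 i (suc (suc (k + e))) , 𝐚) ∷ F ,
  trans (cong (λ t → levels i (suc t) rest) (+-suc k e))
   (cong (λ t → _ ∷ _ ∷ _ ∷ t)
     (trans (cong (λ t → levels (suc i) t rest) (sym (+-suc k e)))
       (trans eq (cong (λ t → F ++ levels t (suc e) rest) (sym (+-suc i k))))))

levels$-split : ∀ i k e rest → ∃ λ F → levels$ i (k + suc e) rest ≡ F ++ levels$ (i + k) (suc e) rest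
levels$-split i zero e rest = [] , cong (λ t → levels$ t (suc e) rest) (sym (+-identityʳ i))
levels$-split i (suc k) e rest with levels$-split (suc i) k e rest
... | (F , eq) = (𝐛 ^ i , 𝐛) ∷ (𝐛𝐚 i , letterBefore i) ∷ (𝐛𝐚𝐛 i , 𝐛) ∷ (𝐛𝐚𝐜 i (suc (suc (k + e))) , 𝐚) ∷ F ,
  trans (cong (λ t → levels$ i (suc t) rest) (+-suc k e))
   (cong (λ t → _ ∷ _ ∷ _ ∷ _ ∷ t)
     (trans (cong (λ t → levels$ (suc i) t rest) (sym (+-suc k e)))
       (trans eq (cong (λ t → F ++ levels$ t (suc e) rest) (sym (+-suc i k))))))

𝐜-levels-split : ∀ i k e rest →
                 ∃ λ F → 𝐜-levels i (k + suc (suc (suc e))) rest ≡ F ++ 𝐜-levels (i + k) (suc (suc (suc e))) rest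
𝐜-levels-split i zero e rest = [] , cong (λ t → 𝐜-levels t (suc (suc (suc e))) rest) (sym (+-identityʳ i))
𝐜-levels-split i (suc k) e rest with 𝐜-levels-split (suc i) k e rest
... | (F , eq) = (𝐜 ^ i ++ 𝐛 ∷ [] , 𝐜) ∷ (𝐜 ^ i ++ 𝐛 ^ suc (suc (suc (k + suc e))) , 𝐚) ∷ F ,
  trans (cong (λ t → 𝐜-levels i (suc t) rest) (+-suc k (suc (suc e))))
   (trans (cong (λ t → 𝐜-levels i (suc (suc t)) rest) (+-suc k (suc e)))
    (cong (λ t → _ ∷ _ ∷ t)
     (trans (cong (λ t → 𝐜-levels (suc i) (suc t) rest) (sym (+-suc k (suc e))))
      (trans (cong (λ t → 𝐜-levels (suc i) t rest) (sym (+-suc k (suc (suc e)))))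
       (trans eq (cong (λ t → F ++ 𝐜-levels t (suc (suc (suc e))) rest) (sym (+-suc i k))))))))

levels-head : ∀ i e rest → ∃ λ T′ → levels i (suc e) rest ≡ (𝐛𝐚 i , letterBefore i) ∷ T′
levels-head i zero rest = _ , refl
levels-head i (suc e) rest = _ , refl

levels$-head : ∀ i e rest → ∃ λ T′ → levels$ i (suc e) rest ≡ (𝐛 ^ i , 𝐛) ∷ T′
levels$-head i zero rest = _ , refl
levels$-head i (suc e) rest = _ , refl

^-suc-++ : ∀ n (c : ℕ) X → c ^ suc n ++ X ≡ c ^ n ++ c ∷ X
^-suc-++ zero    c X = refl
^-suc-++ (suc n) c X = cong (c ∷_) (^-suc-++ n c X)

^-+-++ : ∀ a b (c : ℕ) X → c ^ (a + b) ++ X ≡ c ^ a ++ c ^ b ++ X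
^-+-++ zero    b c X = refl
^-+-++ (suc a) b c X = cong (c ∷_) (^-+-++ a b c X)

𝐛𝐚≼ : ∀ j r → 𝐛𝐚 j ≼ 𝐛 ^ j ++ 𝐚 ∷ r
𝐛𝐚≼ j r = lexLeq-++ (𝐛 ^ j) [ 𝐚 ] (𝐚 ∷ r)

𝐛𝐚𝐛𝐚≺𝐛𝐚𝐛 : ∀ j r → 𝐛 ^ j ++ 𝐚 ∷ 𝐛 ^ j ++ 𝐚 ∷ r ≺ 𝐛𝐚𝐛 j
𝐛𝐚𝐛𝐚≺𝐛𝐚𝐛 j r =
  trans (lexLeq-++ (𝐛 ^ j) (𝐚 ∷ 𝐛 ^ suc j) (𝐚 ∷ 𝐛 ^ j ++ 𝐚 ∷ r))
        (trans (cong (λ t → lexLeq t (𝐛 ^ j ++ 𝐚 ∷ r)) (trans (sym (++-identityʳ (𝐛 ^ suc j))) (^-suc-++ j 𝐛 [])))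
               (lexLeq-++ (𝐛 ^ j) [ 𝐛 ] (𝐚 ∷ r)))

𝐛𝐚𝐛≼ : ∀ i t r → 𝐛𝐚𝐛 (suc i) ≼ 𝐛 ^ suc i ++ 𝐚 ∷ 𝐛 ^ (suc (suc i) + t) ++ r
𝐛𝐚𝐛≼ i t r =
  trans (lexLeq-++ (𝐛 ^ suc i) (𝐚 ∷ 𝐛 ^ suc (suc i)) (𝐚 ∷ 𝐛 ^ (suc (suc i) + t) ++ r))
        (trans (cong (lexLeq (𝐛 ^ suc (suc i))) (^-+-++ (suc (suc i)) t 𝐛 r))
            (prefix-≼ (𝐛 ^ suc (suc i)) (𝐛 ^ t ++ r)))

𝐛𝐚𝐛≺𝐛𝐚𝐜 : ∀ i e j r → 𝐛 ^ i ++ 𝐚 ∷ 𝐛 ^ suc j ++ r ≺ 𝐛𝐚𝐜 i (suc e)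
𝐛𝐚𝐛≺𝐛𝐚𝐜 i e j r = lexLeq-++ (𝐛 ^ i) (𝐚 ∷ 𝐜 ^ suc e) (𝐚 ∷ 𝐛 ^ suc j ++ r)

𝐛𝐚𝐛≼𝐛𝐚𝐜 : ∀ i e r → 𝐛𝐚𝐛 (suc i) ≼ 𝐛 ^ suc i ++ 𝐚 ∷ 𝐜 ^ suc e ++ r
𝐛𝐚𝐛≼𝐛𝐚𝐜 i e r = lexLeq-++ (𝐛 ^ suc i) (𝐚 ∷ 𝐛 ^ suc (suc i)) (𝐚 ∷ 𝐜 ^ suc e ++ r)

𝐛𝐚𝐜𝐛≺𝐛𝐚𝐜 : ∀ i e t r → 𝐛 ^ i ++ 𝐚 ∷ 𝐜 ^ suc e ++ 𝐛 ∷ r ≺ 𝐛𝐚𝐜 i (suc e + suc t)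
𝐛𝐚𝐜𝐛≺𝐛𝐚𝐜 i e t r =
  trans (lexLeq-++ (𝐛 ^ i) (𝐚 ∷ 𝐜 ^ (suc e + suc t)) (𝐚 ∷ 𝐜 ^ suc e ++ 𝐛 ∷ r))
        (trans (cong (λ z → lexLeq z (𝐜 ^ suc e ++ 𝐛 ∷ r))
            (trans (sym (++-identityʳ _)) (^-+-++ (suc e) (suc t) 𝐜 [])))
               (lexLeq-++ (𝐜 ^ suc e) (𝐜 ^ suc t ++ []) (𝐛 ∷ r)))

𝐛𝐚𝐜≼ : ∀ j e r → 𝐛𝐚𝐜 j e ≼ 𝐛 ^ j ++ 𝐚 ∷ 𝐜 ^ e ++ r
𝐛𝐚𝐜≼ j e r = trans (lexLeq-++ (𝐛 ^ j) (𝐚 ∷ 𝐜 ^ e) (𝐚 ∷ 𝐜 ^ e ++ r)) (prefix-≼ (𝐚 ∷ 𝐜 ^ e) r)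

𝐛𝐚≺𝐛𝐛 : ∀ j t r → 𝐛 ^ j ++ 𝐚 ∷ r ≺ 𝐛 ^ suc j ++ t
𝐛𝐚≺𝐛𝐛 j t r = trans (cong (λ z → lexLeq z (𝐛 ^ j ++ 𝐚 ∷ r)) (^-suc-++ j 𝐛 t)) (lexLeq-++ (𝐛 ^ j) (𝐛 ∷ t) (𝐚 ∷ r))

𝐛𝐚≺𝐛ʲ⁺¹ : ∀ j r → 𝐛 ^ j ++ 𝐚 ∷ r ≺ 𝐛 ^ suc j
𝐛𝐚≺𝐛ʲ⁺¹ j r = trans (cong (λ z → lexLeq z (𝐛 ^ j ++ 𝐚 ∷ r)) (sym (++-identityʳ (𝐛 ^ suc j)))) (𝐛𝐚≺𝐛𝐛 j [] r)

𝐜𝐛≼𝐜𝐛 : ∀ i n r → 𝐜 ^ i ++ 𝐛 ^ n ≼ 𝐜 ^ i ++ 𝐛 ^ n ++ r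
𝐜𝐛≼𝐜𝐛 i n r = trans (lexLeq-++ (𝐜 ^ i) (𝐛 ^ n) (𝐛 ^ n ++ r)) (prefix-≼ (𝐛 ^ n) r)

𝐜𝐛≺𝐜𝐜𝐛 : ∀ e n r → 𝐜 ^ suc e ++ 𝐛 ^ suc n ++ r ≺ 𝐜 ^ suc (suc e) ++ [ 𝐛 ]
𝐜𝐛≺𝐜𝐜𝐛 e n r =
  trans (cong (λ z → lexLeq z (𝐜 ^ suc e ++ 𝐛 ^ suc n ++ r)) (^-suc-++ (suc e) 𝐜 [ 𝐛 ]))
        (lexLeq-++ (𝐜 ^ suc e) (𝐜 ∷ [ 𝐛 ]) (𝐛 ^ suc n ++ r))

𝐜𝐛³≼𝐜𝐜𝐛² : ∀ e r → 𝐜 ^ suc e ++ 𝐛 ^ 3 ≼ 𝐜 ^ suc (suc e) ++ 𝐛 ^ 2 ++ r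
𝐜𝐛³≼𝐜𝐜𝐛² e r =
  trans (cong (lexLeq (𝐜 ^ suc e ++ 𝐛 ^ 3)) (^-suc-++ (suc e) 𝐜 (𝐛 ^ 2 ++ r)))
      (lexLeq-++ (𝐜 ^ suc e) (𝐛 ^ 3) (𝐜 ∷ 𝐛 ^ 2 ++ r))

𝐜𝐛≼ : ∀ i n r → 𝐜 ^ i ++ [ 𝐛 ] ≼ 𝐜 ^ i ++ 𝐛 ^ suc n ++ r
𝐜𝐛≼ i n r = lexLeq-++ (𝐜 ^ i) [ 𝐛 ] (𝐛 ^ suc n ++ r)

𝐜𝐛𝐚≺𝐜𝐛𝐛 : ∀ i n t r → 𝐜 ^ i ++ 𝐛 ^ suc n ++ 𝐚 ∷ r ≺ 𝐜 ^ i ++ 𝐛 ^ (suc n + suc t)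
𝐜𝐛𝐚≺𝐜𝐛𝐛 i n t r =
  trans (lexLeq-++ (𝐜 ^ i) (𝐛 ^ (suc n + suc t)) (𝐛 ^ suc n ++ 𝐚 ∷ r))
        (trans (cong (λ z → lexLeq z (𝐛 ^ suc n ++ 𝐚 ∷ r))
            (trans (sym (++-identityʳ _)) (^-+-++ (suc n) (suc t) 𝐛 [])))
               (lexLeq-++ (𝐛 ^ suc n) (𝐛 ^ suc t ++ []) (𝐚 ∷ r)))

𝐛𝐳≼𝐛𝐳 : ∀ i t r → 𝐛 ^ (suc i + t) ++ [ 𝐳 ] ≼ 𝐛 ^ suc i ++ 𝐳 ∷ r
𝐛𝐳≼𝐛𝐳 i t r =
  trans (cong (λ z → lexLeq z (𝐛 ^ suc i ++ 𝐳 ∷ r)) (^-+-++ (suc i) t 𝐛 [ 𝐳 ]))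
        (trans (lexLeq-++ (𝐛 ^ suc i) (𝐛 ^ t ++ [ 𝐳 ]) (𝐳 ∷ r)) (𝐛ᵗ𝐳≼𝐳 t))
  where
  𝐛ᵗ𝐳≼𝐳 : ∀ t → 𝐛 ^ t ++ [ 𝐳 ] ≼ 𝐳 ∷ r
  𝐛ᵗ𝐳≼𝐳 zero    = refl
  𝐛ᵗ𝐳≼𝐳 (suc t) = refl

𝐛𝐛𝐳≺𝐛𝐳 : ∀ e r → 𝐛 ^ suc e ++ 𝐳 ∷ r ≺ 𝐛 ^ e ++ [ 𝐳 ]
𝐛𝐛𝐳≺𝐛𝐳 e r = trans (cong (lexLeq (𝐛 ^ e ++ [ 𝐳 ])) (^-suc-++ e 𝐛 (𝐳 ∷ r))) (lexLeq-++ (𝐛 ^ e) [ 𝐳 ] (𝐛 ∷ 𝐳 ∷ r))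

𝐛$≺𝐛𝐚 : ∀ n r → 𝐛 ^ n ++ 0 ∷ r ≺ 𝐛𝐚 n
𝐛$≺𝐛𝐚 n r = lexLeq-++ (𝐛 ^ n) [ 𝐚 ] (0 ∷ r)

levels-split-≡ : ∀ i k e n rest → k + suc e ≡ n → ∃ λ F → levels i n rest ≡ F ++ levels (i + k) (suc e) rest
levels-split-≡ i k e .(k + suc e) rest refl = levels-split i k e rest

levels$-split-≡ : ∀ i k e n rest → k + suc e ≡ n → ∃ λ F → levels$ i n rest ≡ F ++ levels$ (i + k) (suc e) rest
levels$-split-≡ i k e .(k + suc e) rest refl = levels$-split i k e rest

𝐜-levels-split-≡ : ∀ i k e n rest → k + suc (suc (suc e)) ≡ n →
                   ∃ λ F → 𝐜-levels i n rest ≡ F ++ 𝐜-levels (i + k) (suc (suc (suc e))) rest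
𝐜-levels-split-≡ i k e .(k + suc (suc (suc e))) rest refl = 𝐜-levels-split i k e rest

[2+i]+o≡i+[2+o] : ∀ i o → suc (suc i) + o ≡ i + suc (suc o)
[2+i]+o≡i+[2+o] = solve-∀

[1+i]+t+[1+e]≡i+[2+t+e] : ∀ i t e → suc i + t + suc e ≡ i + suc (suc (t + e))
[1+i]+t+[1+e]≡i+[2+t+e] = solve-∀

[1+e]+[1+t]≡2+t+e : ∀ e t → suc e + suc t ≡ suc (suc (t + e))
[1+e]+[1+t]≡2+t+e = solve-∀

1+[2+k]+[1+e]≡e+[3+k] : ∀ k e → suc (suc k + suc e) ≡ e + suc (suc (suc k))
1+[2+k]+[1+e]≡e+[3+k] = solve-∀

1+k+[2+i+t]≡i+[3+k+t] : ∀ k i t → suc (k + suc (suc i + t)) ≡ i + suc (suc (suc (k + t)))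
1+k+[2+i+t]≡i+[3+k+t] = solve-∀

[2+k]+[1+t]≡3+k+t : ∀ k t → suc (suc k) + suc t ≡ suc (suc (suc (k + t)))
[2+k]+[1+t]≡3+k+t = solve-∀

3+e≡e+3 : ∀ e′ → suc (suc (suc e′)) ≡ e′ + suc (suc (suc zero))
3+e≡e+3 = solve-∀

-- every conjugate lies in a class

lastOr0-word : ∀ e₀ E → NonEmpty E → lastOr0 (word e₀ E) ≡ lastOr0 E
lastOr0-word e₀ E ne = trans (lastOr0-++ (𝐳 ∷ blocks 1 e₀) (𝐛 ^ suc e₀ ++ E) (𝐛 , _ , refl))
    (lastOr0-++ (𝐛 ^ suc e₀) E ne)

lastOr0-word-[] : ∀ e₀ → lastOr0 (word e₀ []) ≡ 𝐛
lastOr0-word-[] e₀ = trans (lastOr0-++ (𝐳 ∷ blocks 1 e₀) (𝐛 ^ suc e₀ ++ []) (𝐛 , _ , refl)) (lastOr0-^-++-[] e₀ 𝐛)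

up-to-tail : ℕ → List Class
up-to-tail e₀ = ([] , 𝐛) ∷ levels 1 e₀ []

classes-split-after-levels : ∀ e₀ → classes e₀ ≡ up-to-tail e₀ ++ after-levels e₀
classes-split-after-levels e₀ = cong (([] , 𝐛) ∷_) (levels-++ 1 e₀ (after-levels e₀))

tail-classes : ℕ → List Class
tail-classes e₀ = (𝐛 ^ suc e₀ , 𝐜) ∷ (𝐛 ^ e₀ ++ 𝐳 ∷ [] , 𝐛) ∷ []

classes-split-𝐜-classes : ∀ e₀ → classes e₀ ≡ (up-to-tail e₀ ++ tail-classes e₀) ++ 𝐜-classes e₀
classes-split-𝐜-classes e₀ = trans (classes-split-after-levels e₀)
    (sym (++-assoc (up-to-tail e₀) (tail-classes e₀) (𝐜-classes e₀)))

classes-at-level : ∀ e₀ k e → k + suc e ≡ e₀ → ∃ λ P → classes e₀ ≡ P ++ levels (suc k) (suc e) (after-levels e₀)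
classes-at-level e₀ k e eq with levels-split-≡ 1 k e e₀ (after-levels e₀) eq
... | (F , h) = ([] , 𝐛) ∷ F , cong (([] , 𝐛) ∷_) h

classes-at-𝐜-level : ∀ e₀ i e′ → i + suc (suc (suc e′)) ≡ suc e₀ →
                     ∃ λ P → classes e₀ ≡ P ++ 𝐜-levels (suc i) (suc (suc (suc e′))) [ ([ 𝐳 ] , 𝐛) ]
classes-at-𝐜-level e₀ i e′ eq with 𝐜-levels-split-≡ 1 i e′ (suc e₀) ((𝐳 ∷ [] , 𝐛) ∷ []) eq
... | (F , h) = P ++ F , trans (classes-split-𝐜-classes e₀) (trans (cong (P ++_) h) (sym (++-assoc P F _)))
  where P = up-to-tail e₀ ++ tail-classes e₀

classes-ends-𝐳 : ∀ e → ∃ λ P → classes e ≡ P ++ [ ([ 𝐳 ] , 𝐛) ]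
classes-ends-𝐳 e =
  P ++ 𝐜-levels 1 (suc e) [] ,
  trans (classes-split-𝐜-classes e) (trans (cong (P ++_) (𝐜-levels-++ 1 (suc e) _)) (sym (++-assoc P _ _)))
  where P = up-to-tail e ++ tail-classes e

classify : ∀ e₀ → 2 ≤ e₀ → ∀ u → u ∈ conjugates (word e₀ []) → InClass (classes e₀) u
classify e₀ le u m with conjugateShape e₀ [] (≤-trans (s≤s z≤n) le) (inj₁ refl) m
... | from-𝐳 refl with P , split ← classes-ends-𝐳 e₀ = inClass P [ 𝐳 ] 𝐛 [] split refl tt (lastOr0-word-[] e₀)
... | from-$ () _ _ _
... | from-tail preceded rest refl =
        inClass (up-to-tail e₀) (𝐛 ^ suc e₀) 𝐜 _ (classes-split-after-levels e₀) (prefix-≼ (𝐛 ^ (suc e₀)) (𝐳 ∷ rest))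
            (𝐛𝐛𝐳≺𝐛𝐳 e₀ rest) preceded
... | from-inside-tail i lt preceded rest refl with e₀ | le | m≤n⇒∃[o]m+o≡n lt
...   | suc (suc e₂) | _ | (t , et) =
        inClass (up-to-tail (suc (suc e₂)) ++ (𝐛 ^ suc (suc (suc e₂)) , 𝐜) ∷ []) (𝐛 ^ suc (suc e₂) ++ 𝐳 ∷ []) 𝐛 _
          (trans (classes-split-after-levels (suc (suc e₂)))
              (sym (++-assoc (up-to-tail (suc (suc e₂))) [ (𝐛 ^ suc (suc (suc e₂)) , 𝐜) ] _)))
          (subst (λ z → 𝐛 ^ z ++ 𝐳 ∷ [] ≼ 𝐛 ^ suc i ++ 𝐳 ∷ rest) et (𝐛𝐳≼𝐛𝐳 i t rest)) refl preceded
...   | suc zero | s≤s () | _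
classify e₀ le u m | from-𝐚 preceded rest refl with e₀ | le
... | suc e₁ | _ = inClass [] [] 𝐛 _ (cong (([] , 𝐛) ∷_) (proj₂ (levels-head 1 e₁ (after-levels (suc e₁))))) refl refl
      preceded
classify e₀ le u m | from-block k zero eq preceded rest refl with classes-at-level e₀ k zero eq
... | (P , h) = inClass P (𝐛𝐚 (suc k)) (letterBefore (suc k)) _ h (𝐛𝐚≼ (suc k) _) (𝐛𝐚𝐛≺𝐛𝐚𝐜 (suc k) 0 k (𝐚 ∷ rest))
      preceded
classify e₀ le u m | from-block k (suc e₂) eq preceded rest refl with classes-at-level e₀ k (suc e₂) eq
... | (P , h) = inClass P (𝐛𝐚 (suc k)) (letterBefore (suc k)) _ h (𝐛𝐚≼ (suc k) _) (𝐛𝐚𝐛𝐚≺𝐛𝐚𝐛 (suc k) rest) preceded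
classify e₀ le u m | from-inside-first-𝐛s i j lt jle preceded rest refl
  with m≤n⇒∃[o]m+o≡n lt | m≤n⇒∃[o]m+o≡n (≤-trans lt jle)
... | (t , refl) | (o , eo) with classes-at-level e₀ i (suc o) (trans (sym ([2+i]+o≡i+[2+o] i o)) eo)
...   | (P , h) = inClass (P ++ (𝐛𝐚 (suc i) , letterBefore (suc i)) ∷ []) (𝐛𝐚𝐛 (suc i)) 𝐛 _
          (trans h (sym (++-assoc P _ _))) (𝐛𝐚𝐛≼ i t rest) (𝐛𝐚𝐛≺𝐛𝐚𝐜 (suc i) (suc o) (suc (i + t)) rest) preceded
classify e₀ le u m | from-second-𝐛s k zero eq preceded rest refl with classes-at-level e₀ k zero eq
... | (P , h) = inClass (P ++ (𝐛𝐚 (suc k) , letterBefore (suc k)) ∷ []) (𝐛𝐚𝐜 (suc k) 1) 𝐚 _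
          (trans h (sym (++-assoc P _ _))) (𝐛𝐚𝐜≼ (suc k) 1 (𝐛 ∷ rest))
          (subst (λ z → 𝐛 ^ suc k ++ 𝐚 ∷ 𝐜 ∷ 𝐛 ∷ rest ≺ 𝐛 ^ suc z)
             (trans (sym (+-comm k 1)) eq)
             (𝐛𝐚≺𝐛ʲ⁺¹ (suc k) (𝐜 ∷ 𝐛 ∷ rest)))
          preceded
classify e₀ le u m | from-second-𝐛s k (suc e₂) eq preceded rest refl with classes-at-level e₀ k (suc e₂) eq
... | (P , h) = inClass (P ++ (𝐛𝐚 (suc k) , letterBefore (suc k)) ∷ [ (𝐛𝐚𝐛 (suc k) , 𝐛) ])
      (𝐛𝐚𝐜 (suc k) (suc (suc e₂))) 𝐚 _
          (trans h (sym (++-assoc P _ _))) (𝐛𝐚𝐜≼ (suc k) (suc (suc e₂)) (𝐛 ∷ rest))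
          (subst (Below _) (sym (proj₂ (levels-head (suc (suc k)) e₂ (after-levels e₀))))
                 (𝐛𝐚≺𝐛𝐛 (suc k) [ 𝐚 ] (𝐜 ^ suc (suc e₂) ++ 𝐛 ∷ rest)))
          preceded
classify e₀ le u m | from-inside-second-𝐛s i k e lt eq preceded rest refl with m≤n⇒∃[o]m+o≡n lt
... | (t , refl) with classes-at-level e₀ i (suc (t + e)) (trans (sym ([1+i]+t+[1+e]≡i+[2+t+e] i t e)) eq)
...   | (P , h) = inClass (P ++ (𝐛𝐚 (suc i) , letterBefore (suc i)) ∷ []) (𝐛𝐚𝐛 (suc i)) 𝐛 _
          (trans h (sym (++-assoc P _ _))) (𝐛𝐚𝐛≼𝐛𝐚𝐜 i e (𝐛 ∷ rest))
          (subst (λ z → 𝐛 ^ suc i ++ 𝐚 ∷ 𝐜 ^ suc e ++ 𝐛 ∷ rest ≺ 𝐛𝐚𝐜 (suc i) z) ([1+e]+[1+t]≡2+t+e e t)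
              (𝐛𝐚𝐜𝐛≺𝐛𝐚𝐜 (suc i) e t rest))
          preceded
classify e₀ le u m | from-𝐜s zero e eq preceded rest refl with e | e₀ | le | eq
... | zero | .1 | s≤s () | refl
... | suc e′ | .(suc (suc e′)) | _ | refl with classes-at-𝐜-level (suc (suc e′)) e′ 0 (sym (3+e≡e+3 e′))
...   | (P , h) = inClass (P ++ (𝐜 ^ suc e′ ++ 𝐛 ∷ [] , 𝐜) ∷ []) (𝐜 ^ suc e′ ++ 𝐛 ^ 3) 𝐚 _
          (trans h (sym (++-assoc P _ _))) (𝐜𝐛³≼𝐜𝐜𝐛² e′ rest) refl preceded
classify e₀ le u m | from-𝐜s (suc k′) e eq preceded rest refl with classes-at-𝐜-level e₀ e k′
    (trans (sym (1+[2+k]+[1+e]≡e+[3+k] k′ e)) (cong suc eq))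
... | (P , h) = inClass (P ++ (𝐜 ^ suc e ++ 𝐛 ∷ [] , 𝐜) ∷ []) (𝐜 ^ suc e ++ 𝐛 ^ suc (suc (suc k′))) 𝐚 _
          (trans h (sym (++-assoc P _ _))) (𝐜𝐛≼𝐜𝐛 (suc e) (suc (suc (suc k′))) rest) (bel k′) preceded
  where
  bel : ∀ k′ → Below (𝐜 ^ suc e ++ 𝐛 ^ suc (suc (suc k′)) ++ rest)
      (𝐜-levels (suc (suc e)) (suc (suc k′)) ((𝐳 ∷ [] , 𝐛) ∷ []))
  bel zero = refl
  bel (suc k″) = 𝐜𝐛≺𝐜𝐜𝐛 e (suc (suc (suc k″))) rest
classify e₀ le u m | from-inside-𝐜s i k e lt eq preceded rest refl with m≤n⇒∃[o]m+o≡n lt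
... | (t , refl) with classes-at-𝐜-level e₀ i (k + t) (trans (sym (1+k+[2+i+t]≡i+[3+k+t] k i t)) (cong suc eq))
...   | (P , h) = inClass P (𝐜 ^ suc i ++ 𝐛 ∷ []) 𝐜 _ h (𝐜𝐛≼ (suc i) (suc k) (𝐚 ∷ rest))
          (subst (λ z → 𝐜 ^ suc i ++ 𝐛 ^ suc (suc k) ++ 𝐚 ∷ rest ≺ 𝐜 ^ suc i ++ 𝐛 ^ z) ([2+k]+[1+t]≡3+k+t k t)
              (𝐜𝐛𝐚≺𝐜𝐛𝐛 (suc i) (suc k) t rest))
          preceded

up-to-tail$ : ℕ → List Class
up-to-tail$ e₀ = ([] , 𝐛) ∷ (𝐚 ∷ [] , 𝐛) ∷ levels$ 1 e₀ []

tail-classes$ : ℕ → List Class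
tail-classes$ e₀ = (𝐛 ^ suc e₀ , 𝐜) ∷ []

classes$-split-after-levels : ∀ e₀ → classes$ e₀ ≡ up-to-tail$ e₀ ++ after-levels$ e₀
classes$-split-after-levels e₀ = cong (λ z → ([] , 𝐛) ∷ (𝐚 ∷ [] , 𝐛) ∷ z) (levels$-++ 1 e₀ (after-levels$ e₀))

classes$-split-𝐜-classes : ∀ e₀ → classes$ e₀ ≡ (up-to-tail$ e₀ ++ tail-classes$ e₀) ++ 𝐜-classes$ e₀
classes$-split-𝐜-classes e₀ = trans (classes$-split-after-levels e₀)
    (sym (++-assoc (up-to-tail$ e₀) (tail-classes$ e₀) (𝐜-classes$ e₀)))

classes$-at-level : ∀ e₀ k e → k + suc e ≡ e₀ → ∃ λ P → classes$ e₀ ≡ P ++ levels$ (suc k) (suc e) (after-levels$ e₀)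
classes$-at-level e₀ k e eq with levels$-split-≡ 1 k e e₀ (after-levels$ e₀) eq
... | (F , h) = ([] , 𝐛) ∷ (𝐚 ∷ [] , 𝐛) ∷ F , cong (λ z → ([] , 𝐛) ∷ (𝐚 ∷ [] , 𝐛) ∷ z) h

classes$-at-𝐜-level : ∀ e₀ i e′ → i + suc (suc (suc e′)) ≡ suc e₀ →
                      ∃ λ P → classes$ e₀ ≡ P ++ 𝐜-levels (suc i) (suc (suc (suc e′))) [ ([ 𝐳 ] , 0) ]
classes$-at-𝐜-level e₀ i e′ eq with 𝐜-levels-split-≡ 1 i e′ (suc e₀) ((𝐳 ∷ [] , 0) ∷ []) eq
... | (F , h) = P ++ F , trans (classes$-split-𝐜-classes e₀) (trans (cong (P ++_) h) (sym (++-assoc P F _)))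
  where P = up-to-tail$ e₀ ++ tail-classes$ e₀

classes$-ends-𝐳 : ∀ e → ∃ λ P → classes$ e ≡ P ++ [ ([ 𝐳 ] , 0) ]
classes$-ends-𝐳 e =
  P ++ 𝐜-levels 1 (suc e) [] ,
  trans (classes$-split-𝐜-classes e) (trans (cong (P ++_) (𝐜-levels-++ 1 (suc e) _)) (sym (++-assoc P _ _)))
  where P = up-to-tail$ e ++ tail-classes$ e

levels$-head₂ : ∀ i e rest → ∃ λ T′ → levels$ i (suc e) rest ≡ (𝐛 ^ i , 𝐛) ∷ (𝐛𝐚 i , letterBefore i) ∷ T′
levels$-head₂ i zero rest = _ , refl
levels$-head₂ i (suc e) rest = _ , refl

classify$ : ∀ e₀ → 2 ≤ e₀ → ∀ u → u ∈ conjugates (word e₀ (0 ∷ [])) → InClass (classes$ e₀) u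
classify$ e₀ le u m with conjugateShape e₀ (0 ∷ []) (≤-trans (s≤s z≤n) le) (inj₂ refl) m
... | from-𝐳 refl with P , split ← classes$-ends-𝐳 e₀ =
  inClass P [ 𝐳 ] 0 [] split refl tt (lastOr0-word e₀ [ 0 ] (0 , [] , refl))
... | from-$ _ preceded rest refl = inClass [] [] 𝐛 _ refl refl refl preceded
... | from-tail preceded rest refl with e₀ | le
...   | suc zero | s≤s ()
...   | suc (suc e₂) | _ =
  inClass (up-to-tail$ (suc (suc e₂))) (𝐛 ^ suc (suc (suc e₂))) 𝐜 _ (classes$-split-after-levels (suc (suc e₂)))
          (prefix-≼ (𝐛 ^ suc (suc (suc e₂))) (0 ∷ 𝐳 ∷ rest)) refl preceded
classify$ e₀ le u m | from-inside-tail i lt preceded rest refl with m≤n⇒∃[o]m+o≡n lt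
... | (t , et) with classes$-at-level e₀ i t (trans (+-suc i t) et)
...   | (P , h) = inClass P (𝐛 ^ suc i) 𝐛 _
          (trans h (cong (P ++_) (proj₂ (levels$-head₂ (suc i) t (after-levels$ e₀)))))
          (prefix-≼ (𝐛 ^ suc i) (0 ∷ 𝐳 ∷ rest)) (𝐛$≺𝐛𝐚 (suc i) (𝐳 ∷ rest)) preceded
classify$ e₀ le u m | from-𝐚 preceded rest refl with e₀ | le
... | suc e₁ | _ =
  inClass [ ([] , 𝐛) ] [ 𝐚 ] 𝐛 _ (cong (λ z → ([] , 𝐛) ∷ ([ 𝐚 ] , 𝐛) ∷ z)
      (proj₂ (levels$-head 1 e₁ (after-levels$ (suc e₁)))))
          refl refl preceded
classify$ e₀ le u m | from-block k zero eq preceded rest refl with classes$-at-level e₀ k zero eq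
... | (P , h) = inClass (P ++ [ (𝐛 ^ suc k , 𝐛) ]) (𝐛𝐚 (suc k)) (letterBefore (suc k)) _
      (trans h (sym (++-assoc P _ _)))
                        (𝐛𝐚≼ (suc k) _) (𝐛𝐚𝐛≺𝐛𝐚𝐜 (suc k) 0 k (𝐚 ∷ rest)) preceded
classify$ e₀ le u m | from-block k (suc e₂) eq preceded rest refl with classes$-at-level e₀ k (suc e₂) eq
... | (P , h) = inClass (P ++ [ (𝐛 ^ suc k , 𝐛) ]) (𝐛𝐚 (suc k)) (letterBefore (suc k)) _
      (trans h (sym (++-assoc P _ _)))
                        (𝐛𝐚≼ (suc k) _) (𝐛𝐚𝐛𝐚≺𝐛𝐚𝐛 (suc k) rest) preceded
classify$ e₀ le u m | from-inside-first-𝐛s i j lt jle preceded rest refl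
  with m≤n⇒∃[o]m+o≡n lt | m≤n⇒∃[o]m+o≡n (≤-trans lt jle)
... | (t , refl) | (o , eo) with classes$-at-level e₀ i (suc o) (trans (sym ([2+i]+o≡i+[2+o] i o)) eo)
...   | (P , h) = inClass (P ++ (𝐛 ^ suc i , 𝐛) ∷ (𝐛𝐚 (suc i) , letterBefore (suc i)) ∷ []) (𝐛𝐚𝐛 (suc i)) 𝐛 _
          (trans h (sym (++-assoc P _ _))) (𝐛𝐚𝐛≼ i t rest) (𝐛𝐚𝐛≺𝐛𝐚𝐜 (suc i) (suc o) (suc (i + t)) rest) preceded
classify$ e₀ le u m | from-second-𝐛s k zero eq preceded rest refl with classes$-at-level e₀ k zero eq
... | (P , h) = inClass (P ++ (𝐛 ^ suc k , 𝐛) ∷ (𝐛𝐚 (suc k) , letterBefore (suc k)) ∷ []) (𝐛𝐚𝐜 (suc k) 1) 𝐚 _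
          (trans h (sym (++-assoc P _ _))) (𝐛𝐚𝐜≼ (suc k) 1 (𝐛 ∷ rest))
          (subst (λ z → 𝐛 ^ suc k ++ 𝐚 ∷ 𝐜 ∷ 𝐛 ∷ rest ≺ 𝐛 ^ suc z)
             (trans (sym (+-comm k 1)) eq)
             (𝐛𝐚≺𝐛ʲ⁺¹ (suc k) (𝐜 ∷ 𝐛 ∷ rest)))
          preceded
classify$ e₀ le u m | from-second-𝐛s k (suc e₂) eq preceded rest refl with classes$-at-level e₀ k (suc e₂) eq
... | (P , h) = inClass (P ++ (𝐛 ^ suc k , 𝐛) ∷ (𝐛𝐚 (suc k) , letterBefore (suc k)) ∷ [ (𝐛𝐚𝐛 (suc k) , 𝐛) ])
                        (𝐛𝐚𝐜 (suc k) (suc (suc e₂))) 𝐚 _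
          (trans h (sym (++-assoc P _ _))) (𝐛𝐚𝐜≼ (suc k) (suc (suc e₂)) (𝐛 ∷ rest))
          (subst (Below _) (sym (proj₂ (levels$-head (suc (suc k)) e₂ (after-levels$ e₀))))
                 (𝐛𝐚≺𝐛ʲ⁺¹ (suc k) (𝐜 ^ suc (suc e₂) ++ 𝐛 ∷ rest)))
          preceded
classify$ e₀ le u m | from-inside-second-𝐛s i k e lt eq preceded rest refl with m≤n⇒∃[o]m+o≡n lt
... | (t , refl) with classes$-at-level e₀ i (suc (t + e)) (trans (sym ([1+i]+t+[1+e]≡i+[2+t+e] i t e)) eq)
...   | (P , h) = inClass (P ++ (𝐛 ^ suc i , 𝐛) ∷ (𝐛𝐚 (suc i) , letterBefore (suc i)) ∷ []) (𝐛𝐚𝐛 (suc i)) 𝐛 _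
          (trans h (sym (++-assoc P _ _))) (𝐛𝐚𝐛≼𝐛𝐚𝐜 i e (𝐛 ∷ rest))
          (subst (λ z → 𝐛 ^ suc i ++ 𝐚 ∷ 𝐜 ^ suc e ++ 𝐛 ∷ rest ≺ 𝐛𝐚𝐜 (suc i) z) ([1+e]+[1+t]≡2+t+e e t)
              (𝐛𝐚𝐜𝐛≺𝐛𝐚𝐜 (suc i) e t rest))
          preceded
classify$ e₀ le u m | from-𝐜s zero e eq preceded rest refl with e | e₀ | le | eq
... | zero | .1 | s≤s () | refl
... | suc e′ | .(suc (suc e′)) | _ | refl with classes$-at-𝐜-level (suc (suc e′)) e′ 0 (sym (3+e≡e+3 e′))
...   | (P , h) = inClass (P ++ (𝐜 ^ suc e′ ++ 𝐛 ∷ [] , 𝐜) ∷ []) (𝐜 ^ suc e′ ++ 𝐛 ^ 3) 𝐚 _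
          (trans h (sym (++-assoc P _ _))) (𝐜𝐛³≼𝐜𝐜𝐛² e′ rest) refl preceded
classify$ e₀ le u m | from-𝐜s (suc k′) e eq preceded rest refl with classes$-at-𝐜-level e₀ e k′
    (trans (sym (1+[2+k]+[1+e]≡e+[3+k] k′ e)) (cong suc eq))
... | (P , h) = inClass (P ++ (𝐜 ^ suc e ++ 𝐛 ∷ [] , 𝐜) ∷ []) (𝐜 ^ suc e ++ 𝐛 ^ suc (suc (suc k′))) 𝐚 _
          (trans h (sym (++-assoc P _ _))) (𝐜𝐛≼𝐜𝐛 (suc e) (suc (suc (suc k′))) rest) (bel k′) preceded
  where
  bel : ∀ k′ → Below (𝐜 ^ suc e ++ 𝐛 ^ suc (suc (suc k′)) ++ rest)
      (𝐜-levels (suc (suc e)) (suc (suc k′)) ((𝐳 ∷ [] , 0) ∷ []))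
  bel zero = refl
  bel (suc k″) = 𝐜𝐛≺𝐜𝐜𝐛 e (suc (suc (suc k″))) rest
classify$ e₀ le u m | from-inside-𝐜s i k e lt eq preceded rest refl with m≤n⇒∃[o]m+o≡n lt
... | (t , refl) with classes$-at-𝐜-level e₀ i (k + t) (trans (sym (1+k+[2+i+t]≡i+[3+k+t] k i t)) (cong suc eq))
...   | (P , h) = inClass P (𝐜 ^ suc i ++ 𝐛 ∷ []) 𝐜 _ h (𝐜𝐛≼ (suc i) (suc k) (𝐚 ∷ rest))
          (subst (λ z → 𝐜 ^ suc i ++ 𝐛 ^ suc (suc k) ++ 𝐚 ∷ rest ≺ 𝐜 ^ suc i ++ 𝐛 ^ z) ([2+k]+[1+t]≡3+k+t k t)
              (𝐜𝐛𝐚≺𝐜𝐛𝐛 (suc i) (suc k) t rest))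
          preceded

-- the boundaries are sorted

𝐛𝐚≼𝐛𝐛 : ∀ i r t → 𝐛 ^ i ++ 𝐚 ∷ r ≼ 𝐛 ^ suc i ++ t
𝐛𝐚≼𝐛𝐛 i r t = trans (cong (lexLeq (𝐛 ^ i ++ 𝐚 ∷ r)) (^-suc-++ i 𝐛 t)) (lexLeq-++ (𝐛 ^ i) (𝐚 ∷ r) (𝐛 ∷ t))

𝐛𝐚≼𝐛ʲ⁺¹ : ∀ i r → 𝐛 ^ i ++ 𝐚 ∷ r ≼ 𝐛 ^ suc i
𝐛𝐚≼𝐛ʲ⁺¹ i r = trans (cong (lexLeq (𝐛 ^ i ++ 𝐚 ∷ r)) (sym (++-identityʳ (𝐛 ^ suc i)))) (𝐛𝐚≼𝐛𝐛 i r [])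

bound-𝐛𝐚𝐛≼𝐛𝐚𝐜 : ∀ i e → 𝐛𝐚𝐛 i ≼ 𝐛𝐚𝐜 i (suc e)
bound-𝐛𝐚𝐛≼𝐛𝐚𝐜 i e = lexLeq-++ (𝐛 ^ i) (𝐚 ∷ 𝐛 ^ suc i) (𝐚 ∷ 𝐜 ^ suc e)

levels-sorted : ∀ i e rest H p rest′ x → rest ≡ (H , p) ∷ rest′ →
  x ≼ 𝐛𝐚 i → (∀ j → suc j ≡ i + suc e → 𝐛𝐚𝐜 j 1 ≼ H) →
  Linked _≼_ (boundaries rest) → Linked _≼_ (x ∷ boundaries (levels i (suc e) rest))
levels-sorted i zero .((H , p) ∷ rest′) H p rest′ x refl x≼ last≼H sorted = x≼ ∷ 𝐛𝐚≼ i (𝐜 ∷ []) ∷ last≼H i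
    (+-comm 1 i) ∷ sorted
levels-sorted i (suc e) rest H p rest′ x eq x≼ last≼H sorted =
  x≼ ∷ 𝐛𝐚≼ i (𝐛 ^ suc i) ∷ bound-𝐛𝐚𝐛≼𝐛𝐚𝐜 i (suc e) ∷
    levels-sorted (suc i) e rest H p rest′ (𝐛𝐚𝐜 i (suc (suc e))) eq (𝐛𝐚≼𝐛𝐛 i (𝐜 ^ suc (suc e)) (𝐚 ∷ []))
       (λ j ej → last≼H j (trans ej (sym (+-suc i (suc e))))) sorted

levels$-sorted : ∀ i e rest H p rest′ x → rest ≡ (H , p) ∷ rest′ →
  x ≼ 𝐛 ^ i → (∀ j → suc j ≡ i + suc e → 𝐛𝐚𝐜 j 1 ≼ H) →
  Linked _≼_ (boundaries rest) → Linked _≼_ (x ∷ boundaries (levels$ i (suc e) rest))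
levels$-sorted i zero .((H , p) ∷ rest′) H p rest′ x refl x≼ last≼H sorted = x≼ ∷ prefix-≼ (𝐛 ^ i) (𝐚 ∷ []) ∷ 𝐛𝐚≼ i
    (𝐜 ∷ []) ∷ last≼H i (+-comm 1 i) ∷ sorted
levels$-sorted i (suc e) rest H p rest′ x eq x≼ last≼H sorted =
  x≼ ∷ prefix-≼ (𝐛 ^ i) (𝐚 ∷ []) ∷ 𝐛𝐚≼ i (𝐛 ^ suc i) ∷ bound-𝐛𝐚𝐛≼𝐛𝐚𝐜 i (suc e) ∷
    levels$-sorted (suc i) e rest H p rest′ (𝐛𝐚𝐜 i (suc (suc e))) eq (𝐛𝐚≼𝐛ʲ⁺¹ i (𝐜 ^ suc (suc e)))
       (λ j ej → last≼H j (trans ej (sym (+-suc i (suc e))))) sorted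

bound-𝐜𝐛≼𝐜𝐛ⁿ : ∀ i n → 𝐜 ^ i ++ 𝐛 ∷ [] ≼ 𝐜 ^ i ++ 𝐛 ^ suc n
bound-𝐜𝐛≼𝐜𝐛ⁿ i n = lexLeq-++ (𝐜 ^ i) (𝐛 ∷ []) (𝐛 ^ suc n)

bound-𝐜𝐛ⁿ≼𝐜𝐜𝐛 : ∀ i n → 𝐜 ^ i ++ 𝐛 ^ suc n ≼ 𝐜 ^ suc i ++ 𝐛 ∷ []
bound-𝐜𝐛ⁿ≼𝐜𝐜𝐛 i n = trans (cong (lexLeq (𝐜 ^ i ++ 𝐛 ^ suc n)) (^-suc-++ i 𝐜 (𝐛 ∷ [])))
    (lexLeq-++ (𝐜 ^ i) (𝐛 ^ suc n) (𝐜 ∷ 𝐛 ∷ []))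

𝐜-levels-sorted : ∀ i e rest H p rest′ x → rest ≡ (H , p) ∷ rest′ →
  x ≼ 𝐜 ^ i ++ 𝐛 ∷ [] → (∀ j n → 𝐜 ^ j ++ 𝐛 ^ suc n ≼ H) →
  Linked _≼_ (boundaries rest) → Linked _≼_ (x ∷ boundaries (𝐜-levels i (suc (suc (suc e))) rest))
𝐜-levels-sorted i zero .((H , p) ∷ rest′) H p rest′ x refl x≼ last≼H sorted =
  x≼ ∷ bound-𝐜𝐛≼𝐜𝐛ⁿ i (suc (suc zero)) ∷ last≼H i (suc (suc zero)) ∷ sorted
𝐜-levels-sorted i (suc e) rest H p rest′ x eq x≼ last≼H sorted =
  x≼ ∷ bound-𝐜𝐛≼𝐜𝐛ⁿ i (suc (suc (suc e))) ∷
    𝐜-levels-sorted (suc i) e rest H p rest′ (𝐜 ^ i ++ 𝐛 ^ suc (suc (suc (suc e)))) eq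
        (bound-𝐜𝐛ⁿ≼𝐜𝐜𝐛 i (suc (suc (suc e)))) last≼H sorted

bound-𝐜𝐛ⁿ≼𝐳 : ∀ j n → 𝐜 ^ j ++ 𝐛 ^ suc n ≼ 𝐳 ∷ []
bound-𝐜𝐛ⁿ≼𝐳 zero n = refl
bound-𝐜𝐛ⁿ≼𝐳 (suc j) n = refl

bound-𝐛𝐛≼𝐛𝐳 : ∀ E → 𝐛 ^ suc E ≼ 𝐛 ^ E ++ 𝐳 ∷ []
bound-𝐛𝐛≼𝐛𝐳 E = trans (cong (λ z → lexLeq z (𝐛 ^ E ++ 𝐳 ∷ [])) (trans (sym (++-identityʳ _)) (^-suc-++ E 𝐛 [])))
    (lexLeq-++ (𝐛 ^ E) (𝐛 ∷ []) (𝐳 ∷ []))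

classes-sorted : ∀ e₀ → 2 ≤ e₀ → Linked _≼_ (boundaries (classes e₀))
classes-sorted (suc zero) (s≤s ())
classes-sorted (suc (suc e₂)) _ =
  levels-sorted 1 (suc e₂) (after ) (𝐛 ^ suc (suc (suc e₂))) 𝐜 _ [] refl refl last-𝐛𝐚𝐜≼
    (bound-𝐛𝐛≼𝐛𝐳 (suc (suc e₂)) ∷
     𝐜-levels-sorted 1 e₂ _ (𝐳 ∷ []) 𝐛 [] (𝐛 ^ suc (suc e₂) ++ 𝐳 ∷ []) refl refl bound-𝐜𝐛ⁿ≼𝐳 [-])
  where
  after = (𝐛 ^ suc (suc (suc e₂)) , 𝐜) ∷ (𝐛 ^ suc (suc e₂) ++ 𝐳 ∷ [] , 𝐛) ∷ 𝐜-levels 1 (suc (suc (suc e₂)))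
      ((𝐳 ∷ [] , 𝐛) ∷ [])
  last-𝐛𝐚𝐜≼ : ∀ j → suc j ≡ 1 + suc (suc e₂) → 𝐛𝐚𝐜 j 1 ≼ 𝐛 ^ suc (suc (suc e₂))
  last-𝐛𝐚𝐜≼ j ej = subst (λ z → 𝐛𝐚𝐜 j 1 ≼ 𝐛 ^ suc z) (suc-injective ej) (𝐛𝐚≼𝐛ʲ⁺¹ j (𝐜 ∷ []))

classes$-sorted : ∀ e₀ → 2 ≤ e₀ → Linked _≼_ (boundaries (classes$ e₀))
classes$-sorted (suc zero) (s≤s ())
classes$-sorted (suc (suc e₂)) _ =
  refl ∷ levels$-sorted 1 (suc e₂) after (𝐛 ^ suc (suc (suc e₂))) 𝐜 _ (𝐚 ∷ []) refl refl last-𝐛𝐚𝐜≼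
    (𝐜-levels-sorted 1 e₂ _ (𝐳 ∷ []) 0 [] (𝐛 ^ suc (suc (suc e₂))) refl refl bound-𝐜𝐛ⁿ≼𝐳 [-])
  where
  after = (𝐛 ^ suc (suc (suc e₂)) , 𝐜) ∷ 𝐜-levels 1 (suc (suc (suc e₂))) ((𝐳 ∷ [] , 0) ∷ [])
  last-𝐛𝐚𝐜≼ : ∀ j → suc j ≡ 1 + suc (suc e₂) → 𝐛𝐚𝐜 j 1 ≼ 𝐛 ^ suc (suc (suc e₂))
  last-𝐛𝐚𝐜≼ j ej = subst (λ z → 𝐛𝐚𝐜 j 1 ≼ 𝐛 ^ suc z) (suc-injective ej) (𝐛𝐚≼𝐛ʲ⁺¹ j (𝐜 ∷ []))

-- every class is inhabited

blocks-+ : ∀ j k n → ∃ λ BN → blocks j (k + n) ≡ BN ++ blocks (j + k) n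
blocks-+ j zero n = [] , cong (λ t → blocks t n) (sym (+-identityʳ j))
blocks-+ j (suc k) n with blocks-+ (suc j) k n
... | (BN , eq) = block j (suc (k + n)) ++ BN ,
  trans (cong (block j (suc (k + n)) ++_) (trans eq (cong (λ t → BN ++ blocks t n) (sym (+-suc j k)))))
        (sym (++-assoc (block j (suc (k + n))) BN _))

after-block : ℕ → List ℕ → ℕ → ℕ → List ℕ
after-block e₀ E k e = blocks (suc (suc k)) e ++ (𝐛 ^ suc e₀ ++ E)

word-at-block : ∀ e₀ E k e → k + suc e ≡ e₀ →
                ∃ λ Pre → word e₀ E ≡ (𝐳 ∷ Pre) ++ (block (suc k) (suc e) ++ after-block e₀ E k e)
word-at-block .(k + suc e) E k e refl with blocks-+ 1 k (suc e)
... | (BN , eq) = BN , cong (𝐳 ∷_)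
  (trans (cong (_++ (𝐛 ^ suc (k + suc e) ++ E)) eq)
   (trans (++-assoc BN _ _) (cong (BN ++_) (++-assoc (block (suc k) (suc e)) (blocks (suc (suc k)) e) _))))

ConjugateOf : ℕ → List ℕ → List ℕ → Set
ConjugateOf e₀ E u = u ∈ conjugates (word e₀ E)

conjugate-in-block : ∀ e₀ E k e x y y0 ys → k + suc e ≡ e₀ → x ++ y ≡ block (suc k) (suc e) → y ≡ y0 ∷ ys →
  ∃ λ Pre → ConjugateOf e₀ E (y ++ (after-block e₀ E k e ++ (𝐳 ∷ Pre ++ x)))
conjugate-in-block e₀ E k e x y y0 ys eq xy refl with word-at-block e₀ E k e eq
... | (Pre , h) = Pre ,
  subst (ConjugateOf e₀ E) (++-assoc y (after-block e₀ E k e) (𝐳 ∷ Pre ++ x))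
    (∈-conjugates⁺ (𝐳 ∷ Pre ++ x) y0 (ys ++ after-block e₀ E k e)
      (trans h (trans (cong (λ t → (𝐳 ∷ Pre) ++ (t ++ after-block e₀ E k e)) (sym xy))
        (trans (cong (λ t → (𝐳 ∷ Pre) ++ t) (++-assoc x y (after-block e₀ E k e)))
          (sym (++-assoc (𝐳 ∷ Pre) x (y ++ after-block e₀ E k e)))))))

ConjugateWithPrefix : ℕ → List ℕ → List ℕ → Set
ConjugateWithPrefix e₀ E P = ∃ λ u → ConjugateOf e₀ E u × ∃ λ r → u ≡ P ++ r

conjugate-𝐛𝐚𝐛𝐚 : ∀ e₀ E k e → k + suc e ≡ e₀ → ConjugateWithPrefix e₀ E (𝐛 ^ suc k ++ 𝐚 ∷ 𝐛 ^ suc k ++ 𝐚 ∷ [])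
conjugate-𝐛𝐚𝐛𝐚 e₀ E k e eq with conjugate-in-block e₀ E k e [] (block (suc k) (suc e)) 𝐛 _ eq refl refl
... | (Pre , m) =
  _ , m , _ , trans (trans (++-assoc (𝐛 ^ suc k) _ _) (cong (λ t → 𝐛 ^ suc k ++ 𝐚 ∷ t) (++-assoc (𝐛 ^ suc k) _ _)))
                    (sym (++-∷-++-∷-assoc (𝐛 ^ suc k) 𝐚 (𝐛 ^ suc k) 𝐚 [] _))

conjugate-𝐛𝐚𝐛𝐛𝐚 : ∀ e₀ E k e → suc k + suc e ≡ e₀ →
                  ConjugateWithPrefix e₀ E (𝐛 ^ suc k ++ 𝐚 ∷ 𝐛 ^ suc (suc k) ++ 𝐚 ∷ [])
conjugate-𝐛𝐚𝐛𝐛𝐚 e₀ E k e eq with conjugate-in-block e₀ E (suc k) e (𝐛 ∷ [])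
    (𝐛 ^ suc k ++ 𝐚 ∷ 𝐛 ^ suc (suc k) ++ 𝐚 ∷ 𝐜 ^ suc e) 𝐛 _ eq refl refl
... | (Pre , m) =
  _ , m , _ , trans (trans (++-assoc (𝐛 ^ suc k) _ _) (cong (λ t → 𝐛 ^ suc k ++ 𝐚 ∷ t) (++-assoc (𝐛 ^ suc (suc k)) _ _)))
                    (sym (++-∷-++-∷-assoc (𝐛 ^ suc k) 𝐚 (𝐛 ^ suc (suc k)) 𝐚 [] _))

conjugate-𝐛𝐚𝐜𝐛 : ∀ e₀ E k e → k + suc e ≡ e₀ → ConjugateWithPrefix e₀ E (𝐛 ^ suc k ++ 𝐚 ∷ 𝐜 ^ suc e ++ 𝐛 ∷ [])
conjugate-𝐛𝐚𝐜𝐛 e₀ E k e eq with conjugate-in-block e₀ E k e (𝐛 ^ suc k ++ 𝐚 ∷ []) (𝐛 ^ suc k ++ 𝐚 ∷ 𝐜 ^ suc e) 𝐛 _ eq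
    (++-assoc (𝐛 ^ suc k) (𝐚 ∷ []) _) refl
... | (Pre , m) = _ , m , proj₁ pb ++ p ,
    trans (++-assoc (𝐛 ^ suc k) (𝐚 ∷ 𝐜 ^ suc e) (after-block e₀ E k e ++ p))
     (trans (cong (λ z → 𝐛 ^ suc k ++ 𝐚 ∷ z)
              (trans (cong (λ z → 𝐜 ^ suc e ++ (z ++ p)) (proj₂ pb))
                  (sym (++-assoc (𝐜 ^ suc e) (𝐛 ∷ []) (proj₁ pb ++ p)))))
       (sym (++-assoc (𝐛 ^ suc k) (𝐚 ∷ 𝐜 ^ suc e ++ 𝐛 ∷ []) (proj₁ pb ++ p))))
  where
  p = 𝐳 ∷ Pre ++ 𝐛 ^ suc k ++ 𝐚 ∷ []
  pb = following-𝐛 (suc k) e e₀ E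

conjugate-𝐚 : ∀ e₀ E e → 0 + suc e ≡ e₀ → ConjugateWithPrefix e₀ E (𝐚 ∷ [])
conjugate-𝐚 e₀ E e eq with conjugate-in-block e₀ E 0 e (𝐛 ∷ []) (𝐚 ∷ 𝐛 ∷ 𝐚 ∷ 𝐜 ^ suc e) 𝐚 _ eq refl refl
... | (Pre , m) = _ , m , _ , refl

conjugate-tail : ∀ e₀ E → ConjugateWithPrefix e₀ E (𝐛 ^ suc e₀ ++ E ++ 𝐳 ∷ [])
conjugate-tail e₀ E = _ , m , blocks 1 e₀ ,
  trans (++-assoc (𝐛 ^ suc e₀) E _) (trans (cong (𝐛 ^ suc e₀ ++_) (sym (++-assoc E (𝐳 ∷ []) _)))
      (sym (++-assoc (𝐛 ^ suc e₀) (E ++ 𝐳 ∷ []) _)))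
  where
  m : ConjugateOf e₀ E ((𝐛 ∷ 𝐛 ^ e₀ ++ E) ++ 𝐳 ∷ blocks 1 e₀)
  m = ∈-conjugates⁺ (𝐳 ∷ blocks 1 e₀) 𝐛 (𝐛 ^ e₀ ++ E) refl

1+[1+i+t]≡[1+t]+[1+i] : ∀ i t → suc (suc i + t) ≡ suc t + suc i
1+[1+i+t]≡[1+t]+[1+i] = solve-∀

conjugate-inside-tail : ∀ e₀ E i t → suc i + t ≡ e₀ → ConjugateWithPrefix e₀ E (𝐛 ^ suc i ++ E ++ 𝐳 ∷ [])
conjugate-inside-tail .(suc i + t) E i t refl = _ , m , blocks 1 (suc i + t) ++ 𝐛 ^ suc t ,
  trans (++-assoc (𝐛 ^ suc i) E _) (trans (cong (𝐛 ^ suc i ++_) (sym (++-assoc E (𝐳 ∷ []) _)))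
      (sym (++-assoc (𝐛 ^ suc i) (E ++ 𝐳 ∷ []) _)))
  where
  e₀ = suc i + t
  eqw : word e₀ E ≡ (𝐳 ∷ blocks 1 e₀ ++ 𝐛 ^ suc t) ++ (𝐛 ∷ 𝐛 ^ i ++ E)
  eqw = cong (𝐳 ∷_) (trans (cong (λ z → blocks 1 e₀ ++ z ++ E)
      (trans (cong (λ z → 𝐛 ^ z) (1+[1+i+t]≡[1+t]+[1+i] i t)) (^-+ (suc t) (suc i) 𝐛)))
           (trans (cong (blocks 1 e₀ ++_) (++-assoc (𝐛 ^ suc t) (𝐛 ^ suc i) E))
               (sym (++-assoc (blocks 1 e₀) (𝐛 ^ suc t) _))))
  m : ConjugateOf e₀ E ((𝐛 ∷ 𝐛 ^ i ++ E) ++ 𝐳 ∷ blocks 1 e₀ ++ 𝐛 ^ suc t)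
  m = ∈-conjugates⁺ (𝐳 ∷ blocks 1 e₀ ++ 𝐛 ^ suc t) 𝐛 (𝐛 ^ i ++ E) eqw

conjugate-𝐜𝐛𝐛𝐚 : ∀ e₀ E i a → suc a + suc i ≡ e₀ → ConjugateWithPrefix e₀ E (𝐜 ^ suc i ++ 𝐛 ^ 2 ++ 𝐚 ∷ [])
conjugate-𝐜𝐛𝐛𝐚 e₀ E i a eq with conjugate-in-block e₀ E 0 (a + suc i) (𝐛 ∷ 𝐚 ∷ 𝐛 ∷ 𝐚 ∷ 𝐜 ^ suc a) (𝐜 ^ suc i) 𝐜 _ eq
                          (cong (λ z → 𝐛 ∷ 𝐚 ∷ 𝐛 ∷ 𝐚 ∷ z) (sym (^-+ (suc a) (suc i) 𝐜))) refl
... | (Pre , m) = _ , m , proj₁ pb ++ p ,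
    trans (cong (λ z → 𝐜 ^ suc i ++ (z ++ p))
        (trans (cong (λ z → blocks 2 z ++ (𝐛 ^ suc e₀ ++ E)) (+-suc a i)) (proj₂ pb)))
      (trans (cong (𝐜 ^ suc i ++_) (++-assoc (𝐛 ^ 2) (𝐚 ∷ proj₁ pb) p))
        (sym (trans (++-assoc (𝐜 ^ suc i) (𝐛 ^ 2 ++ 𝐚 ∷ []) _) (cong (𝐜 ^ suc i ++_) (++-assoc (𝐛 ^ 2) (𝐚 ∷ []) _)))))
  where
  p = 𝐳 ∷ Pre ++ (𝐛 ∷ 𝐚 ∷ 𝐛 ∷ 𝐚 ∷ 𝐜 ^ suc a)
  pb = following-𝐛ʲ𝐚 1 (a + i) e₀ E

conjugate-𝐜𝐛 : ∀ e₀ E k e → k + suc e ≡ e₀ → ConjugateWithPrefix e₀ E (𝐜 ^ suc e ++ 𝐛 ^ suc (suc k))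
conjugate-𝐜𝐛 e₀ E k e eq with conjugate-in-block e₀ E k e (𝐛 ^ suc k ++ 𝐚 ∷ 𝐛 ^ suc k ++ 𝐚 ∷ []) (𝐜 ^ suc e) 𝐜 _ eq
                          (++-∷-++-∷-assoc (𝐛 ^ suc k) 𝐚 (𝐛 ^ suc k) 𝐚 [] (𝐜 ^ suc e)) refl
... | (Pre , m) = _ , m , proj₁ pb ++ p ,
    trans (cong (λ z → 𝐜 ^ suc e ++ (z ++ p)) (proj₂ pb))
      (trans (cong (𝐜 ^ suc e ++_) (++-assoc (𝐛 ^ suc (suc k)) (proj₁ pb) p))
        (sym (++-assoc (𝐜 ^ suc e) (𝐛 ^ suc (suc k)) _)))
  where
  p = 𝐳 ∷ Pre ++ (𝐛 ^ suc k ++ 𝐚 ∷ 𝐛 ^ suc k ++ 𝐚 ∷ [])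
  pb = following-𝐛ʲ (suc k) e e₀ E (cong suc eq)

conjugate-$ : ∀ e₀ → ConjugateWithPrefix e₀ (0 ∷ []) (0 ∷ [])
conjugate-$ e₀ = _ , ∈-conjugates⁺ (𝐳 ∷ blocks 1 e₀ ++ 𝐛 ^ suc e₀) 0 []
                 (cong (𝐳 ∷_) (sym (++-assoc (blocks 1 e₀) (𝐛 ^ suc e₀) (0 ∷ [])))) , _ , refl

conjugate-𝐳 : ∀ e₀ E → ConjugateOf e₀ E (word e₀ E)
conjugate-𝐳 e₀ E = subst (ConjugateOf e₀ E) (++-identityʳ (word e₀ E)) (∈-conjugates⁺ [] 𝐳 _ refl)

Witness : ℕ → List ℕ → List ℕ → List Class → Set
Witness e₀ E B post = ∃ λ u → ConjugateOf e₀ E u × B ≼ u × Below u post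

witness : ∀ e₀ E P B post → ConjugateWithPrefix e₀ E P → (∀ r → B ≼ P ++ r × Below (P ++ r) post) →
          Witness e₀ E B post
witness e₀ E P B post (u , m , r , refl) f = _ , m , proj₁ (f r) , proj₂ (f r)

InhabitedBy : ℕ → List ℕ → List Class → Set
InhabitedBy e₀ E Cls = Inhabited (conjugates (word e₀ E)) Cls

witness-𝐛𝐚 : ∀ e₀ E k e → k + suc e ≡ e₀ → ∀ post →
  (∀ r → Below (𝐛 ^ suc k ++ 𝐚 ∷ 𝐛 ^ suc k ++ 𝐚 ∷ r) post) → Witness e₀ E (𝐛𝐚 (suc k)) post
witness-𝐛𝐚 e₀ E k e eq post bf = witness e₀ E _ (𝐛𝐚 (suc k)) post (conjugate-𝐛𝐚𝐛𝐚 e₀ E k e eq) λ r →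
  subst (λ z → 𝐛𝐚 (suc k) ≼ z × Below z post) (sym (++-∷-++-∷-assoc (𝐛 ^ suc k) 𝐚 (𝐛 ^ suc k) 𝐚 [] r))
      (𝐛𝐚≼ (suc k) _ , bf r)

witness-𝐛𝐚𝐛 : ∀ e₀ E k e → suc k + suc e ≡ e₀ → ∀ e′ post′ →
  Witness e₀ E (𝐛𝐚𝐛 (suc k)) ((𝐛𝐚𝐜 (suc k) (suc e′) , 𝐚) ∷ post′)
witness-𝐛𝐚𝐛 e₀ E k e eq e′ post′ = witness e₀ E _ (𝐛𝐚𝐛 (suc k)) ((𝐛𝐚𝐜 (suc k) (suc e′) , 𝐚) ∷ post′)
    (conjugate-𝐛𝐚𝐛𝐛𝐚 e₀ E k e eq) λ r →
  subst (λ z → 𝐛𝐚𝐛 (suc k) ≼ z × Below z ((𝐛𝐚𝐜 (suc k) (suc e′) , 𝐚) ∷ post′))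
      (sym (++-∷-++-∷-assoc (𝐛 ^ suc k) 𝐚 (𝐛 ^ suc (suc k)) 𝐚 [] r))
    (trans (lexLeq-++ (𝐛 ^ suc k) (𝐚 ∷ 𝐛 ^ suc (suc k)) _) (prefix-≼ (𝐚 ∷ 𝐛 ^ suc (suc k)) (𝐚 ∷ r)) ,
     𝐛𝐚𝐛≺𝐛𝐚𝐜 (suc k) e′ (suc k) (𝐚 ∷ r))

witness-𝐛𝐚𝐜 : ∀ e₀ E k e → k + suc e ≡ e₀ → ∀ post →
  (∀ r → Below (𝐛 ^ suc k ++ 𝐚 ∷ 𝐜 ^ suc e ++ 𝐛 ∷ r) post) → Witness e₀ E (𝐛𝐚𝐜 (suc k) (suc e)) post
witness-𝐛𝐚𝐜 e₀ E k e eq post bf = witness e₀ E _ (𝐛𝐚𝐜 (suc k) (suc e)) post (conjugate-𝐛𝐚𝐜𝐛 e₀ E k e eq) λ r →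
  subst (λ z → 𝐛𝐚𝐜 (suc k) (suc e) ≼ z × Below z post) (sym (++-∷-++-∷-assoc (𝐛 ^ suc k) 𝐚 (𝐜 ^ suc e) 𝐛 [] r))
      (𝐛𝐚𝐜≼ (suc k) (suc e) (𝐛 ∷ r) , bf r)

[1+k]+[1+e]≡k+[2+e] : ∀ k e → suc k + suc e ≡ k + suc (suc e)
[1+k]+[1+e]≡k+[2+e] = solve-∀

levels-inhabited : ∀ e₀ k e → k + suc e ≡ e₀ → InhabitedBy e₀ [] (after-levels e₀) → InhabitedBy e₀ []
    (levels (suc k) (suc e) (after-levels e₀))
levels-inhabited e₀ k zero eq w =
  witness-𝐛𝐚 e₀ [] k 0 eq ((𝐛𝐚𝐜 (suc k) 1 , 𝐚) ∷ after-levels e₀) (λ r → 𝐛𝐚𝐛≺𝐛𝐚𝐜 (suc k) 0 k (𝐚 ∷ r)) ,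
  witness-𝐛𝐚𝐜 e₀ [] k 0 eq (after-levels e₀) (λ r → subst (λ z → 𝐛 ^ suc k ++ 𝐚 ∷ 𝐜 ^ 1 ++ 𝐛 ∷ r ≺ 𝐛 ^ suc z)
                                    (trans (sym (+-comm k 1)) eq) (𝐛𝐚≺𝐛ʲ⁺¹ (suc k) _)) ,
  w
levels-inhabited e₀ k (suc e) eq w =
  witness-𝐛𝐚 e₀ [] k (suc e) eq ((𝐛𝐚𝐛 (suc k) , 𝐛) ∷ (𝐛𝐚𝐜 (suc k) (suc (suc e)) , 𝐚) ∷ levels (suc (suc k)) (suc e)
      (after-levels e₀)) (λ r → 𝐛𝐚𝐛𝐚≺𝐛𝐚𝐛 (suc k) r) ,
  witness-𝐛𝐚𝐛 e₀ [] k e (trans ([1+k]+[1+e]≡k+[2+e] k e) eq) (suc e) (levels (suc (suc k)) (suc e) (after-levels e₀))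
      ,
  witness-𝐛𝐚𝐜 e₀ [] k (suc e) eq (levels (suc (suc k)) (suc e) (after-levels e₀))
    (λ r → subst (Below (𝐛 ^ suc k ++ 𝐚 ∷ 𝐜 ^ suc (suc e) ++ 𝐛 ∷ r))
        (sym (proj₂ (levels-head (suc (suc k)) e (after-levels e₀)))) (𝐛𝐚≺𝐛𝐛 (suc k) (𝐚 ∷ []) _)) ,
  levels-inhabited e₀ (suc k) e (trans ([1+k]+[1+e]≡k+[2+e] k e) eq) w

witness-𝐛ⁱ : ∀ e₀ k e → k + suc e ≡ e₀ → ∀ post′ →
  Witness e₀ (0 ∷ []) (𝐛 ^ suc k) ((𝐛𝐚 (suc k) , letterBefore (suc k)) ∷ post′)
witness-𝐛ⁱ e₀ k e eq post′ = witness e₀ (0 ∷ []) _ (𝐛 ^ suc k) ((𝐛𝐚 (suc k) , letterBefore (suc k)) ∷ post′)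
  (conjugate-inside-tail e₀ (0 ∷ []) k e (trans (sym (+-suc k e)) eq)) λ r →
  subst (λ z → 𝐛 ^ suc k ≼ z × Below z ((𝐛𝐚 (suc k) , letterBefore (suc k)) ∷ post′))
    (sym (++-assoc (𝐛 ^ suc k) (0 ∷ 𝐳 ∷ []) r)) (prefix-≼ (𝐛 ^ (suc k)) _ , 𝐛$≺𝐛𝐚 (suc k) (𝐳 ∷ r))

levels$-inhabited : ∀ e₀ k e → k + suc e ≡ e₀ → InhabitedBy e₀ (0 ∷ []) (after-levels$ e₀) → InhabitedBy e₀ (0 ∷ [])
    (levels$ (suc k) (suc e) (after-levels$ e₀))
levels$-inhabited e₀ k zero eq w =
  witness-𝐛ⁱ e₀ k 0 eq ((𝐛𝐚𝐜 (suc k) 1 , 𝐚) ∷ after-levels$ e₀) ,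
  witness-𝐛𝐚 e₀ (0 ∷ []) k 0 eq ((𝐛𝐚𝐜 (suc k) 1 , 𝐚) ∷ after-levels$ e₀) (λ r → 𝐛𝐚𝐛≺𝐛𝐚𝐜 (suc k) 0 k (𝐚 ∷ r)) ,
  witness-𝐛𝐚𝐜 e₀ (0 ∷ []) k 0 eq (after-levels$ e₀) (λ r → subst (λ z → 𝐛 ^ suc k ++ 𝐚 ∷ 𝐜 ^ 1 ++ 𝐛 ∷ r ≺ 𝐛 ^ suc z)
                                    (trans (sym (+-comm k 1)) eq) (𝐛𝐚≺𝐛ʲ⁺¹ (suc k) _)) ,
  w
levels$-inhabited e₀ k (suc e) eq w =
  witness-𝐛ⁱ e₀ k (suc e) eq ((𝐛𝐚𝐛 (suc k) , 𝐛) ∷ (𝐛𝐚𝐜 (suc k) (suc (suc e)) , 𝐚) ∷ levels$ (suc (suc k)) (suc e)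
      (after-levels$ e₀)) ,
  witness-𝐛𝐚 e₀ (0 ∷ []) k (suc e) eq ((𝐛𝐚𝐛 (suc k) , 𝐛) ∷ (𝐛𝐚𝐜 (suc k) (suc (suc e)) , 𝐚) ∷ levels$ (suc (suc k))
      (suc e) (after-levels$ e₀)) (λ r → 𝐛𝐚𝐛𝐚≺𝐛𝐚𝐛 (suc k) r) ,
  witness-𝐛𝐚𝐛 e₀ (0 ∷ []) k e (trans ([1+k]+[1+e]≡k+[2+e] k e) eq) (suc e)
      (levels$ (suc (suc k)) (suc e) (after-levels$ e₀)) ,
  witness-𝐛𝐚𝐜 e₀ (0 ∷ []) k (suc e) eq (levels$ (suc (suc k)) (suc e) (after-levels$ e₀))
    (λ r → subst (Below (𝐛 ^ suc k ++ 𝐚 ∷ 𝐜 ^ suc (suc e) ++ 𝐛 ∷ r))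
        (sym (proj₂ (levels$-head (suc (suc k)) e (after-levels$ e₀)))) (𝐛𝐚≺𝐛ʲ⁺¹ (suc k) _)) ,
  levels$-inhabited e₀ (suc k) e (trans ([1+k]+[1+e]≡k+[2+e] k e) eq) w

[1+e]+[1+i]≡i+[2+e] : ∀ i e → suc e + suc i ≡ i + suc (suc e)
[1+e]+[1+i]≡i+[2+e] = solve-∀

[1+i]+[2+e]≡i+[3+e] : ∀ i e → suc i + suc (suc e) ≡ i + suc (suc (suc e))
[1+i]+[2+e]≡i+[3+e] = solve-∀

witness-𝐜𝐛 : ∀ e₀ E i e → i + suc (suc e) ≡ e₀ → Witness e₀ E (𝐜 ^ suc i ++ 𝐛 ∷ [])
    ((𝐜 ^ suc i ++ 𝐛 ^ suc (suc (suc e)) , 𝐚) ∷ [])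
witness-𝐜𝐛 e₀ E i e eq =
  witness e₀ E _ (𝐜 ^ suc i ++ 𝐛 ∷ []) ((𝐜 ^ suc i ++ 𝐛 ^ suc (suc (suc e)) , 𝐚) ∷ [])
      (conjugate-𝐜𝐛𝐛𝐚 e₀ E i e (trans ([1+e]+[1+i]≡i+[2+e] i e) eq)) (λ r →
    subst (λ z → 𝐜 ^ suc i ++ 𝐛 ∷ [] ≼ z × z ≺ 𝐜 ^ suc i ++ 𝐛 ^ suc (suc (suc e)))
      (sym (++-assoc (𝐜 ^ suc i) (𝐛 ^ 2 ++ 𝐚 ∷ []) r))
      (𝐜𝐛≼ (suc i) 1 (𝐚 ∷ r) , 𝐜𝐛𝐚≺𝐜𝐛𝐛 (suc i) 1 e r))

𝐜-levels-inhabited : ∀ e₀ E p i e → i + suc (suc e) ≡ e₀ → InhabitedBy e₀ E ((𝐳 ∷ [] , p) ∷ []) →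
  InhabitedBy e₀ E (𝐜-levels (suc i) (suc (suc (suc e))) ((𝐳 ∷ [] , p) ∷ []))
𝐜-levels-inhabited e₀ E p i zero eq w =
  witness-𝐜𝐛 e₀ E i 0 eq ,
  witness e₀ E _ (𝐜 ^ suc i ++ 𝐛 ^ 3) ((𝐳 ∷ [] , p) ∷ []) (conjugate-𝐜𝐛 e₀ E 1 i (trans ([1+e]+[1+i]≡i+[2+e] i 0) eq))
      (λ r →
    subst (λ z → 𝐜 ^ suc i ++ 𝐛 ^ 3 ≼ z × z ≺ 𝐳 ∷ [])
      (sym (++-assoc (𝐜 ^ suc i) (𝐛 ^ 3) r))
      (𝐜𝐛≼𝐜𝐛 (suc i) _ r , refl)) ,
  w
𝐜-levels-inhabited e₀ E p i (suc e) eq w =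
  witness-𝐜𝐛 e₀ E i (suc e) eq ,
  witness e₀ E _ (𝐜 ^ suc i ++ 𝐛 ^ suc (suc (suc (suc e))))
      (𝐜-levels (suc (suc i)) (suc (suc (suc e))) ((𝐳 ∷ [] , p) ∷ []))
          (conjugate-𝐜𝐛 e₀ E (suc (suc e)) i (trans ([1+e]+[1+i]≡i+[2+e] i (suc e)) eq)) (λ r →
    subst (λ z → 𝐜 ^ suc i ++ 𝐛 ^ suc (suc (suc (suc e))) ≼ z × z ≺ 𝐜 ^ suc (suc i) ++ 𝐛 ∷ [])
      (sym (++-assoc (𝐜 ^ suc i) (𝐛 ^ suc (suc (suc (suc e)))) r))
      (𝐜𝐛≼𝐜𝐛 (suc i) _ r , 𝐜𝐛≺𝐜𝐜𝐛 i (suc (suc (suc e))) r)) ,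
  𝐜-levels-inhabited e₀ E p (suc i) e (trans ([1+i]+[2+e]≡i+[3+e] i e) eq) w

classes-inhabited : ∀ e₀ → 2 ≤ e₀ → InhabitedBy e₀ [] (classes e₀)
classes-inhabited (suc zero) (s≤s ())
classes-inhabited (suc (suc e₂)) _ =
  witness e₀ [] (𝐚 ∷ []) [] (levels 1 e₀ (after-levels e₀)) (conjugate-𝐚 e₀ [] (suc e₂) refl)
    (λ r → refl , subst (Below (𝐚 ∷ r)) (sym (proj₂ (levels-head 1 (suc e₂) (after-levels e₀)))) refl) ,
  levels-inhabited e₀ 0 (suc e₂) refl
    (witness e₀ [] _ (𝐛 ^ suc e₀) ((𝐛 ^ e₀ ++ 𝐳 ∷ [] , 𝐛) ∷ 𝐜-levels 1 (suc e₀) ((𝐳 ∷ [] , 𝐛) ∷ []))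
        (conjugate-tail e₀ []) (λ r →
       subst (λ z → 𝐛 ^ suc e₀ ≼ z × z ≺ 𝐛 ^ e₀ ++ 𝐳 ∷ [])
         (sym (++-assoc (𝐛 ^ suc e₀) (𝐳 ∷ []) r)) (prefix-≼ (𝐛 ^ (suc e₀)) _ , 𝐛𝐛𝐳≺𝐛𝐳 e₀ r)) ,
     witness e₀ [] _ (𝐛 ^ e₀ ++ 𝐳 ∷ []) (𝐜-levels 1 (suc e₀) ((𝐳 ∷ [] , 𝐛) ∷ []))
         (conjugate-inside-tail e₀ [] (suc e₂) 0 (cong suc (cong suc (+-identityʳ e₂)))) (λ r →
       (prefix-≼ (𝐛 ^ e₀ ++ 𝐳 ∷ []) r , refl)) ,
     𝐜-levels-inhabited e₀ [] 𝐛 0 e₂ refl ((word e₀ [] , conjugate-𝐳 e₀ [] , refl , tt) , tt))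
  where e₀ = suc (suc e₂)

classes$-inhabited : ∀ e₀ → 2 ≤ e₀ → InhabitedBy e₀ (0 ∷ []) (classes$ e₀)
classes$-inhabited (suc zero) (s≤s ())
classes$-inhabited (suc (suc e₂)) _ =
  witness e₀ (0 ∷ []) (0 ∷ []) [] ((𝐚 ∷ [] , 𝐛) ∷ levels$ 1 e₀ (after-levels$ e₀)) (conjugate-$ e₀)
      (λ r → refl , refl) ,
  witness e₀ (0 ∷ []) (𝐚 ∷ []) (𝐚 ∷ []) (levels$ 1 e₀ (after-levels$ e₀)) (conjugate-𝐚 e₀ (0 ∷ []) (suc e₂) refl)
    (λ r → refl , subst (Below (𝐚 ∷ r)) (sym (proj₂ (levels$-head 1 (suc e₂) (after-levels$ e₀)))) refl) ,
  levels$-inhabited e₀ 0 (suc e₂) refl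
    (witness e₀ (0 ∷ []) _ (𝐛 ^ suc e₀) (𝐜-levels 1 (suc e₀) ((𝐳 ∷ [] , 0) ∷ [])) (conjugate-tail e₀ (0 ∷ [])) (λ r →
       subst (λ z → 𝐛 ^ suc e₀ ≼ z × z ≺ 𝐜 ∷ 𝐛 ∷ [])
         (sym (++-assoc (𝐛 ^ suc e₀) (0 ∷ 𝐳 ∷ []) r)) (prefix-≼ (𝐛 ^ (suc e₀)) _ , refl)) ,
     𝐜-levels-inhabited e₀ (0 ∷ []) 0 0 e₂ refl ((word e₀ (0 ∷ []) , conjugate-𝐳 e₀ (0 ∷ []) , refl , tt) , tt))
  where e₀ = suc (suc e₂)

-- runs of the class letters

data IsAB : ℕ → Set where
  is𝐚 : IsAB 𝐚
  is𝐛 : IsAB 𝐛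

runsFrom-levels : ∀ i e rest x → IsAB x → runsFrom x (letters (levels i (suc e) rest)) ≡ 3 * e + 2 + runsFrom 𝐚
    (letters rest)
runsFrom-levels (suc zero)    zero rest .𝐚 is𝐚 = refl
runsFrom-levels (suc zero)    zero rest .𝐛 is𝐛 = refl
runsFrom-levels zero          zero rest .𝐚 is𝐚 = refl
runsFrom-levels zero          zero rest .𝐛 is𝐛 = refl
runsFrom-levels (suc (suc i)) zero rest .𝐚 is𝐚 = refl
runsFrom-levels (suc (suc i)) zero rest .𝐛 is𝐛 = refl
runsFrom-levels i (suc e) rest x x∈𝐚𝐛 =
  trans (first-level i x x∈𝐚𝐛) (trans (cong (3 +_) (runsFrom-levels (suc i) e rest 𝐚 is𝐚)) (collect e _))
  where
  first-level : ∀ i x → IsAB x →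
                runsFrom x (letters (levels i (suc (suc e)) rest)) ≡ 3 + runsFrom 𝐚
                    (letters (levels (suc i) (suc e) rest))
  first-level (suc zero)    .𝐚 is𝐚 = refl
  first-level (suc zero)    .𝐛 is𝐛 = refl
  first-level zero          .𝐚 is𝐚 = refl
  first-level zero          .𝐛 is𝐛 = refl
  first-level (suc (suc i)) .𝐚 is𝐚 = refl
  first-level (suc (suc i)) .𝐛 is𝐛 = refl
  collect : ∀ e t → 3 + (3 * e + 2 + t) ≡ 3 * suc e + 2 + t
  collect = solve-∀

runsFrom-levels$ : ∀ i e rest x → IsAB x →
                   runsFrom x (letters (levels$ i (suc e) rest)) ≡ newRun x 𝐛 +
                       (2 + 4 * e + runsFrom 𝐚 (letters rest))
runsFrom-levels$ (suc zero)    zero rest .𝐚 is𝐚 = refl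
runsFrom-levels$ (suc zero)    zero rest .𝐛 is𝐛 = refl
runsFrom-levels$ zero          zero rest .𝐚 is𝐚 = refl
runsFrom-levels$ zero          zero rest .𝐛 is𝐛 = refl
runsFrom-levels$ (suc (suc i)) zero rest .𝐚 is𝐚 = refl
runsFrom-levels$ (suc (suc i)) zero rest .𝐛 is𝐛 = refl
runsFrom-levels$ i (suc e) rest x x∈𝐚𝐛 =
  trans (first-level i x x∈𝐚𝐛)
        (cong (newRun x 𝐛 +_) (trans (cong (3 +_) (runsFrom-levels$ (suc i) e rest 𝐚 is𝐚)) (collect e _)))
  where
  first-level : ∀ i x → IsAB x → runsFrom x (letters (levels$ i (suc (suc e)) rest)) ≡
                                 newRun x 𝐛 + (3 + runsFrom 𝐚 (letters (levels$ (suc i) (suc e) rest)))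
  first-level (suc zero)    .𝐚 is𝐚 = refl
  first-level (suc zero)    .𝐛 is𝐛 = refl
  first-level zero          .𝐚 is𝐚 = refl
  first-level zero          .𝐛 is𝐛 = refl
  first-level (suc (suc i)) .𝐚 is𝐚 = refl
  first-level (suc (suc i)) .𝐛 is𝐛 = refl
  collect : ∀ e t → 3 + (1 + (2 + 4 * e + t)) ≡ 2 + 4 * suc e + t
  collect = solve-∀

runsFrom-𝐜-levels : ∀ i e rest x →
                    runsFrom x (letters (𝐜-levels i (3 + e) rest)) ≡ newRun x 𝐜 +
                        (1 + 2 * e + runsFrom 𝐚 (letters rest))
runsFrom-𝐜-levels i zero    rest x = refl
runsFrom-𝐜-levels i (suc e) rest x =
  cong (newRun x 𝐜 +_) (trans (cong (1 +_) (runsFrom-𝐜-levels (suc i) e rest 𝐚)) (collect e _))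
  where
  collect : ∀ e t → 2 + (1 + 2 * e + t) ≡ 1 + 2 * suc e + t
  collect = solve-∀

runs-classes : ∀ e → runs (letters (classes (2 + e))) ≡ 5 * e + 11
runs-classes e =
  trans (cong suc (runsFrom-levels 1 (suc e) _ 𝐛 is𝐛))
        (trans (cong (λ t → suc (3 * suc e + 2 + (1 + (1 + t)))) (runsFrom-𝐜-levels 1 e [ (𝐳 ∷ [] , 𝐛) ] 𝐛))
            (collect e))
  where
  collect : ∀ e → suc (3 * suc e + 2 + (1 + (1 + (1 + (1 + 2 * e + 1))))) ≡ 5 * e + 11
  collect = solve-∀

runs-classes$ : ∀ e → runs (letters (classes$ (2 + e))) ≡ 6 * e + 10
runs-classes$ e =
  trans (cong suc (runsFrom-levels$ 1 (suc e) _ 𝐛 is𝐛))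
        (trans (cong (λ t → suc (0 + (2 + 4 * suc e + (1 + t)))) (runsFrom-𝐜-levels 1 e [ (𝐳 ∷ [] , 0) ] 𝐜))
            (collect e))
  where
  collect : ∀ e → suc (0 + (2 + 4 * suc e + (1 + (0 + (1 + 2 * e + 1))))) ≡ 6 * e + 10
  collect = solve-∀

decode : ℕ → Fin 4
decode 1 = fz
decode 2 = fs fz
decode 3 = fs (fs fz)
decode _ = fs (fs (fs fz))

Decodable : ℕ → Set
Decodable x = suc (toℕ (decode x)) ≡ x

encode-decode : ∀ w → All Decodable w → encode (map decode w) ≡ w
encode-decode w decodable = trans (sym (map-∘ w)) (trans (map-cong-local decodable) (map-id w))

block-decodable : ∀ j e → All Decodable (block j e)
block-decodable j e = ++⁺ (replicate⁺ j refl) (refl All.∷ ++⁺ (replicate⁺ j refl) (refl All.∷ replicate⁺ e refl))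

blocks-decodable : ∀ j e → All Decodable (blocks j e)
blocks-decodable j zero    = All.[]
blocks-decodable j (suc e) = ++⁺ (block-decodable j (suc e)) (blocks-decodable (suc j) e)

word-decodable : ∀ e → All Decodable (word e [])
word-decodable e = refl All.∷ ++⁺ (blocks-decodable 1 e) (++⁺ (replicate⁺ (suc e) refl) All.[])

word-[]-++ : ∀ e E → word e [] ++ E ≡ word e E
word-[]-++ e E = cong (𝐳 ∷_) (trans (++-assoc (blocks 1 e) _ E) (cong (blocks 1 e ++_) (++-assoc (𝐛 ^ suc e) [] E)))

runs-bwt-word : ∀ e → 2 ≤ e → runs (bwt (word e [])) ≡ runs (letters (classes e))
runs-bwt-word e 2≤e =
  runs-by-classes (conjugates (word e [])) (classes e) (classes-sorted e 2≤e) (classes-inhabited e 2≤e)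
      (classify e 2≤e _)

runs-bwt-word$ : ∀ e → 2 ≤ e → runs (bwt (word e [ 0 ])) ≡ runs (letters (classes$ e))
runs-bwt-word$ e 2≤e =
  runs-by-classes (conjugates (word e [ 0 ])) (classes$ e) (classes$-sorted e 2≤e) (classes$-inhabited e 2≤e)
      (classify$ e 2≤e _)

length-block : ∀ j e → length (block j e) ≡ j + suc (j + suc e)
length-block j e =
  trans (length-++ (𝐛 ^ j)) (cong₂ _+_ (length-replicate j)
    (cong suc (trans (length-++ (𝐛 ^ j)) (cong₂ _+_ (length-replicate j) (cong suc (length-replicate e))))))

length-blocks : ∀ j e → 2 * length (blocks j e) ≡ e * (4 * j + 3 * e + 3)
length-blocks j zero    = refl
length-blocks j (suc e) = begin
  2 * length (block j (suc e) ++ blocks (suc j) e)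
    ≡⟨ cong (2 *_) (length-++ (block j (suc e))) ⟩
  2 * (length (block j (suc e)) + length (blocks (suc j) e))
    ≡⟨ cong (λ n → 2 * (n + length (blocks (suc j) e))) (length-block j (suc e)) ⟩
  2 * (j + suc (j + suc (suc e)) + length (blocks (suc j) e))
    ≡⟨ *-distribˡ-+ 2 (j + suc (j + suc (suc e))) _ ⟩
  2 * (j + suc (j + suc (suc e))) + 2 * length (blocks (suc j) e)
    ≡⟨ cong (2 * (j + suc (j + suc (suc e))) +_) (length-blocks (suc j) e) ⟩
  2 * (j + suc (j + suc (suc e))) + e * (4 * suc j + 3 * e + 3)
    ≡⟨ step j e ⟩
  suc e * (4 * j + 3 * suc e + 3) ∎
  where
  open ≡-Reasoning
  step : ∀ j e → 2 * (j + suc (j + suc (suc e))) + e * (4 * suc j + 3 * e + 3) ≡ suc e * (4 * j + 3 * suc e + 3)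
  step = solve-∀

length-word : ∀ e → 2 * length (word e []) ≡ 3 * e * e + 9 * e + 4
length-word e = begin
  2 * suc (length (blocks 1 e ++ 𝐛 ^ suc e ++ []))
    ≡⟨ cong (λ n → 2 * suc n) (length-++ (blocks 1 e)) ⟩
  2 * suc (length (blocks 1 e) + length (𝐛 ^ suc e ++ []))
    ≡⟨ cong (λ n → 2 * suc (length (blocks 1 e) + n)) tail-length ⟩
  2 * suc (length (blocks 1 e) + suc e)
    ≡⟨ distrib e (length (blocks 1 e)) ⟩
  2 * length (blocks 1 e) + (2 * e + 4)
    ≡⟨ cong (_+ (2 * e + 4)) (length-blocks 1 e) ⟩
  e * (4 * 1 + 3 * e + 3) + (2 * e + 4)
    ≡⟨ collect e ⟩
  3 * e * e + 9 * e + 4 ∎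
  where
  open ≡-Reasoning
  tail-length : length (𝐛 ^ suc e ++ []) ≡ suc e
  tail-length = trans (cong length (++-identityʳ (𝐛 ^ suc e))) (length-replicate (suc e))
  distrib : ∀ e L → 2 * suc (L + suc e) ≡ 2 * L + (2 * e + 4)
  distrib = solve-∀
  collect : ∀ e → e * (4 * 1 + 3 * e + 3) + (2 * e + 4) ≡ 3 * e * e + 9 * e + 4
  collect = solve-∀

family : ℕ → List (Fin 4)
family i = map decode (word (4 + i) [])

r-family : ∀ i → r (family i) ≡ 5 * i + 21
r-family i = begin
  runs (bwt (encode (family i)))
    ≡⟨ cong (runs ∘ bwt) (encode-decode _ (word-decodable (4 + i))) ⟩
  runs (bwt (word (4 + i) []))
    ≡⟨ runs-bwt-word (4 + i) (s≤s (s≤s z≤n)) ⟩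
  runs (letters (classes (4 + i)))
    ≡⟨ cong (λ e → runs (letters (classes e))) {4 + i} {2 + (2 + i)} refl ⟩
  runs (letters (classes (2 + (2 + i))))
    ≡⟨ runs-classes (2 + i) ⟩
  5 * (2 + i) + 11
    ≡⟨ simplify i ⟩
  5 * i + 21 ∎
  where
  open ≡-Reasoning
  simplify : ∀ i → 5 * (2 + i) + 11 ≡ 5 * i + 21
  simplify = solve-∀

r$-family : ∀ i → r$ (family i) ≡ 6 * i + 22
r$-family i = begin
  runs (bwt (encode (family i) ++ [ 0 ]))
    ≡⟨ cong (λ w → runs (bwt (w ++ [ 0 ]))) (encode-decode _ (word-decodable (4 + i))) ⟩
  runs (bwt (word (4 + i) [] ++ [ 0 ]))
    ≡⟨ cong (runs ∘ bwt) (word-[]-++ (4 + i) [ 0 ]) ⟩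
  runs (bwt (word (4 + i) [ 0 ]))
    ≡⟨ runs-bwt-word$ (4 + i) (s≤s (s≤s z≤n)) ⟩
  runs (letters (classes$ (4 + i)))
    ≡⟨ cong (λ e → runs (letters (classes$ e))) {4 + i} {2 + (2 + i)} refl ⟩
  runs (letters (classes$ (2 + (2 + i))))
    ≡⟨ runs-classes$ (2 + i) ⟩
  6 * (2 + i) + 10
    ≡⟨ simplify i ⟩
  6 * i + 22 ∎
  where
  open ≡-Reasoning
  simplify : ∀ i → 6 * (2 + i) + 10 ≡ 6 * i + 22
  simplify = solve-∀

length-family : ∀ i → 2 * length (family i) ≡ 3 * i * i + 33 * i + 88
length-family i = trans (cong (2 *_) (length-map decode (word (4 + i) []))) (trans (length-word (4 + i)) (simplify i))
  where
  simplify : ∀ i → 3 * (4 + i) * (4 + i) + 9 * (4 + i) + 4 ≡ 3 * i * i + 33 * i + 88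
  simplify = solve-∀

family-growing : ∀ i → length (family i) < length (family (suc i))
family-growing i = *-cancelˡ-< 2 _ _ (subst₂ _<_ (sym (length-family i)) (sym (length-family (suc i))) (grows i))
  where
  step : ∀ i → 3 * i * i + 33 * i + 88 + suc (6 * i + 35) ≡ 3 * suc i * suc i + 33 * suc i + 88
  step = solve-∀
  grows : ∀ i → 3 * i * i + 33 * i + 88 < 3 * suc i * suc i + 33 * suc i + 88
  grows i = subst (3 * i * i + 33 * i + 88 <_) (step i) (m<m+n (3 * i * i + 33 * i + 88) z<s)

≤-of-+ : ∀ m {n} k → m + k ≡ n → m ≤ n
≤-of-+ m k refl = m≤m+n m k

[6i+22]∸[5i+21]≡1+i : ∀ i → 6 * i + 22 ∸ (5 * i + 21) ≡ suc i
[6i+22]∸[5i+21]≡1+i i = trans (cong (_∸ (5 * i + 21)) (split i)) (m+n∸m≡n (5 * i + 21) (suc i))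
  where
  split : ∀ i → 6 * i + 22 ≡ 5 * i + 21 + suc i
  split = solve-∀

length≤49[1+i]² : ∀ i {n} → 2 * n ≡ 3 * i * i + 33 * i + 88 → n ≤ 49 * (suc i * suc i)
length≤49[1+i]² i {n} 2n≡ =
  *-cancelˡ-≤ {n} {49 * (suc i * suc i)} 2
    (subst (_≤ 2 * (49 * (suc i * suc i))) (sym 2n≡)
        (≤-of-+ (3 * i * i + 33 * i + 88) (95 * i * i + 163 * i + 10) (gap i)))
  where
  gap : ∀ i → 3 * i * i + 33 * i + 88 + (95 * i * i + 163 * i + 10) ≡ 2 * (49 * (suc i * suc i))
  gap = solve-∀

[1+i]²≤length : ∀ i {n} → 2 * n ≡ 3 * i * i + 33 * i + 88 → suc i * suc i ≤ n
[1+i]²≤length i {n} 2n≡ =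
  *-cancelˡ-≤ {suc i * suc i} {n} 2
    (subst (2 * (suc i * suc i) ≤_) (sym 2n≡) (≤-of-+ (2 * (suc i * suc i)) (i * i + 29 * i + 86) (gap i)))
  where
  gap : ∀ i → 2 * (suc i * suc i) + (i * i + 29 * i + 86) ≡ 3 * i * i + 33 * i + 88
  gap = solve-∀

-- With n = |family i| and d = r$ − r = i + 1, the length 2n = 3i² + 33i + 88 lies between 2d² and 98d².
Θ-bounds : ∀ i {a b n} → a ≡ 5 * i + 21 → b ≡ 6 * i + 22 → 2 * n ≡ 3 * i * i + 33 * i + 88 →
           a ≤ b × n ≤ (7 * 7) * ((b ∸ a) * (b ∸ a)) × (b ∸ a) * (b ∸ a) ≤ 1 * n
Θ-bounds i {n = n} refl refl 2n≡ =
  subst (λ d → 5 * i + 21 ≤ 6 * i + 22 × n ≤ (7 * 7) * (d * d) × d * d ≤ 1 * n) (sym ([6i+22]∸[5i+21]≡1+i i))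
    ( ≤-of-+ (5 * i + 21) (suc i) (gap i)
    , length≤49[1+i]² i 2n≡
    , subst (suc i * suc i ≤_) (sym (*-identityˡ n)) ([1+i]²≤length i 2n≡))
  where
  gap : ∀ i → 5 * i + 21 + suc i ≡ 6 * i + 22
  gap = solve-∀

proposition14 : ∃ λ σ → Σ (ℕ → List (Fin σ)) λ f →
    ((i : ℕ) → length (f i) < length (f (suc i))) ×
    (∃ λ k → ∃ λ C → (i : ℕ) →
    (r (f i) ≤ r$ (f i)) ×
    (length (f i) ≤ (k * k) * ((r$ (f i) ∸ r (f i)) * (r$ (f i) ∸ r (f i)))) ×
    ((r$ (f i) ∸ r (f i)) * (r$ (f i) ∸ r (f i)) ≤ C * length (f i)))
proposition14 = 4 , family , family-growing , 7 , 1 , λ i →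
  Θ-bounds i (r-family i) (r$-family i) (length-family i)
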